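{- Let $b\ge2$ be an integer. If $k,m,n$ are integers with $2\leq m<k$ and $G_k(m)<n<G_k(m+1)$, then $s_b(n)<J_{k,m}(n)$, where \[J_{k,m}(x)=\frac{H_k(m+1)-H_k(m)}{G_k(m+1)-G_k(m)}(x-G_k(m))+H_k(m).\]
   Context: Fix an integer $b\ge 2$. A base $b$ over-expansion of a positive integer $N$ is a word $d_kd_{k-1}\cdots d_0$ over $\{0,1,\ldots,b\}$ with $d_k\neq 0$ and $\sum_{i=0}^k d_ib^i=N$. For $n\ge 2$, $s_b(n)$ is the number of base $b$ over-expansions of $n-1$; $s_b(0)=0$, $s_b(1)=1$. The integers $h_m$ are defined by $h_1=h_2=1$ and, for $m\geq 3$, $h_m=1+\sum_{i=0}^{\lfloor (m-3)/2\rfloor}b^{m-2-2i}$. For integers $2\le m\le k$, $G_k(m)=b^k+h_m$ and $H_k(m)=F_{m+2}+(k-m)F_m$, where $F_j$ are the Fibonacci numbers with $F_1=F_2=1$. -}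

module Defs where

open import Data.Nat using (ℕ; zero; suc; _+_; _*_; _^_; _∸_; _/_)
open import Data.Nat.Properties using (_≟_)
open import Data.List using (List; []; _∷_; map; concatMap; upTo; filter; length; foldl)
open import Data.Nat.ListAction using (sum)
open import Data.Bool using (Bool; true; false; _∧_; not)
open import Relation.Nullary.Decidable using (⌊_⌋)
open import Data.Integer as ℤ using (ℤ)

F : ℕ → ℕ
F 0 = 0
F 1 = 1
F (suc (suc n)) = F (suc n) + F n

-- All words of length L over the alphabet {0,1,...,b}, written d_{L-1} ... d_0
-- (most significant digit first).
words : ℕ → ℕ → List (List ℕ)
words b zero    = [] ∷ []
words b (suc L) = concatMap (λ d → map (d ∷_) (words b L)) (upTo (suc b))

value : ℕ → List ℕ → ℕ
value b = foldl (λ acc d → acc * b + d) 0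

isOverExp : ℕ → ℕ → List ℕ → Bool
isOverExp b N []      = false
isOverExp b N (d ∷ w) = not ⌊ d ≟ 0 ⌋ ∧ ⌊ value b (d ∷ w) ≟ N ⌋
  where import Data.Bool

wordsUpTo : ℕ → ℕ → List (List ℕ)
wordsUpTo b zero    = []
wordsUpTo b (suc L) = words b (suc L) Data.List.++ wordsUpTo b L
  where import Data.List

-- number of base-b over-expansions of N ≥ 1.  Any over-expansion d_k...d_0 of N
-- has b^k ≤ N, hence length k+1 ≤ N+1 (as b ≥ 2), so enumerating lengths
-- 1..N+1 covers all of them; each word is listed exactly once.
overExpCount : ℕ → ℕ → ℕ
overExpCount b N = length (filter (λ w → isOverExp b N w Data.Bool.≟ true) (wordsUpTo b (suc N)))
  where import Data.Bool

s : ℕ → ℕ → ℕ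
s b 0 = 0
s b 1 = 1
s b (suc (suc n)) = overExpCount b (suc n)

h : ℕ → ℕ → ℕ
h b 0 = 0   -- unused
h b 1 = 1
h b 2 = 1
h b m@(suc (suc (suc _))) =
  1 + sum (map (λ i → b ^ (m ∸ 2 ∸ 2 * i)) (upTo (suc ((m ∸ 3) / 2))))

G : ℕ → ℕ → ℕ → ℕ
G b k m = b ^ k + h b m

H : ℕ → ℕ → ℕ
H k m = F (m + 2) + (k ∸ m) * F m

-- Let ways L N count the words of length L over {0, ..., b} of value N, leading zeros allowed, so that
-- s (N + 1) = ways L N as soon as N < b ^ L.  Cutting a word into its top and bottom digits gives
-- s (a b ^ L + w + 1) = s (a + 1) ways L w + s a ways L (b ^ L + w).  Hence the pair
-- (p , q) = (ways L w , ways L (b ^ L + w)) is transformed by a new leading digit 0, 1 or ≥ 2 into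
-- (p , p + q), (p + q , q) or (p + q , 0), and s (b ^ (i + m) + u + 1) = i p + (p + q) for the pair at
-- level m.  Along this recursion the pair stays in the box p , q ≤ F (L + 1), p + q ≤ F (L + 2), and the
-- weights F j p + F (j + 1) q are at most F (L + j + 1), with equality only at u + 1 = h L.  For
-- h m < u + 1 < h (m + 1) this yields p + q < F (m + 2) and, by induction on m, that p lies below the chord
-- from (h m , F m) to (h (m + 1) , F (m + 1)): between two consecutive h j the value is an interpolation of
-- the peak values, and those lie below the chord because the gaps h (L + 1) - h L grow faster than the
-- Fibonacci numbers.  Adding the two bounds, the first i times, is the chord inequality for s.

module Submission where

open import Defs
open import Data.Nat
open import Data.Nat.Properties
open import Data.Nat.Tactic.RingSolver using (solve-∀)
open import Data.Nat.DivMod using (_/_; _%_; m/n≡1+[m∸n]/n; m%n<n; m≡m%n+[m/n]*n)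
open import Data.Nat.ListAction using (sum)
open import Data.Bool using (true; false)
open import Data.Bool.Properties using (T-≡)
open import Data.Empty using (⊥-elim)
import Data.Integer as ℤ
import Data.Integer.Properties as ℤ
open import Data.List using (List; []; _∷_; _++_; map; concatMap; upTo; applyUpTo; filter; length; foldl)
open import Data.List.Properties using (map-applyUpTo; map-upTo; map-cong; filter-++; filter-none; length-++)
open import Data.List.Relation.Unary.All as All using (All; []; _∷_)
open import Data.List.Relation.Unary.All.Properties using (concat⁺; map⁺)
open import Data.Product using (_×_; _,_; proj₁; proj₂; ∃-syntax)
open import Data.Sum using (inj₁; inj₂)
open import Data.Nat.Induction using (Acc; acc; <-wellFounded)
open import Function using (_∘_; _⇔_; mk⇔; Equivalence)
open import Level using (0ℓ)
open import Relation.Binary.PropositionalEquality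
open import Relation.Nullary using (yes; no; ¬_; does)
open import Relation.Nullary.Decidable using (⌊_⌋; toWitness; fromWitness)
open import Relation.Unary using (Pred; Decidable; ∁)

F-≤-suc : ∀ n → F n ≤ F (suc n)
F-≤-suc zero    = z≤n
F-≤-suc (suc n) = m≤m+n (F (suc n)) (F n)

F-suc-pos : ∀ n → 1 ≤ F (suc n)
F-suc-pos zero    = ≤-refl
F-suc-pos (suc n) = ≤-trans (F-suc-pos n) (F-≤-suc (suc n))

F-pos : ∀ {j} → 2 ≤ j → 1 ≤ F j
F-pos {suc j} _ = F-suc-pos j

F-<-suc : ∀ {j} → 2 ≤ j → F j < F (suc j)
F-<-suc {suc (suc j)} _ = m<m+n (F (suc (suc j))) (F-suc-pos j)
F-<-suc {suc zero} (s≤s ())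

F-+ : ∀ m n → F (suc (m + n)) ≡ F (suc m) * F (suc n) + F m * F n
F-+ zero    n = sym (trans (+-identityʳ _) (+-identityʳ _))
F-+ (suc m) n = begin
  F (suc (suc m + n))                              ≡⟨ cong (λ k → F (suc k)) (sym (+-suc m n)) ⟩
  F (suc (m + suc n))                              ≡⟨ F-+ m (suc n) ⟩
  F (suc m) * (F (suc n) + F n) + F m * F (suc n)  ≡⟨ regroup (F (suc m)) (F m) (F (suc n)) (F n) ⟩
  (F (suc m) + F m) * F (suc n) + F (suc m) * F n  ∎
  where
  open ≡-Reasoning
  regroup : ∀ a b c d → a * (c + d) + b * c ≡ (a + b) * c + a * d
  regroup = solve-∀

F-≤-2* : ∀ n → F (suc (suc n)) ≤ 2 * F (suc n)
F-≤-2* n = +-monoʳ-≤ (F (suc n)) (≤-trans (F-≤-suc n) (m≤m+n _ 0))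

F-≤-3* : ∀ n → F (3 + n) ≤ 3 * F (suc n)
F-≤-3* n = ≤-trans (+-monoˡ-≤ (F (suc n)) (F-≤-2* n)) (≤-reflexive (2x+x≡3x (F (suc n))))
  where
  2x+x≡3x : ∀ x → 2 * x + x ≡ 3 * x
  2x+x≡3x = solve-∀

F-+-≡ : ∀ {k} m n → k ≡ m + n → F (suc k) ≡ F (suc m) * F (suc n) + F m * F n
F-+-≡ m n refl = F-+ m n

sum-upTo-suc : ∀ (f g : ℕ → ℕ) → (∀ i → f (suc i) ≡ g i) → ∀ n →
               sum (map f (upTo (suc n))) ≡ f 0 + sum (map g (upTo n))
sum-upTo-suc f g f∘suc≗g n = cong (λ xs → f 0 + sum xs) (begin
  map f (applyUpTo suc n)         ≡⟨ map-applyUpTo suc f n ⟩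
  applyUpTo (f ∘ suc) n           ≡⟨ sym (map-upTo (f ∘ suc) n) ⟩
  map (f ∘ suc) (upTo n)          ≡⟨ map-cong f∘suc≗g (upTo n) ⟩
  map g (upTo n)                  ∎)
  where open ≡-Reasoning

1*B+w+1≡B+[w+1] : ∀ B w → suc (1 * B + w) ≡ B + suc w
1*B+w+1≡B+[w+1] B w = trans (cong (λ x → suc (x + w)) (*-identityˡ B)) (sym (+-suc B w))

a*B+w<c*B : ∀ {a c B w} → w < B → a < c → a * B + w < c * B
a*B+w<c*B {a} {c} {B} {w} w<B a<c = begin-strict
  a * B + w   <⟨ +-monoʳ-< (a * B) w<B ⟩
  a * B + B   ≡⟨ +-comm (a * B) B ⟩
  suc a * B   ≤⟨ *-monoˡ-≤ B a<c ⟩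
  c * B       ∎
  where open ≤-Reasoning

m<n⇒∃[i]suc-i+m≡n : ∀ {m n} → m < n → ∃[ i ] suc i + m ≡ n
m<n⇒∃[i]suc-i+m≡n {m} m<n with m≤n⇒∃[o]m+o≡n m<n
... | i , refl = i , cong suc (+-comm i m)

⌊≟⌋≡true⇔≡ : ∀ m n → (⌊ m ≟ n ⌋ ≡ true) ⇔ (m ≡ n)
⌊≟⌋≡true⇔≡ m n = mk⇔ (toWitness ∘ Equivalence.from T-≡) (Equivalence.to T-≡ ∘ fromWitness)

infix 4 _≤_strictIf_

_≤_strictIf_ : ℕ → ℕ → Set → Set
x ≤ y strictIf C = x ≤ y × (C → x < y)

<⇒≤strictIf : ∀ {x y} {C : Set} → x < y → x ≤ y strictIf C
<⇒≤strictIf x<y = <⇒≤ x<y , λ _ → x<y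

module Gaps (b' : ℕ) where

  b : ℕ
  b = 2 + b'

  b≥2 : 2 ≤ b
  b≥2 = s≤s (s≤s z≤n)

  b^-pos : ∀ n → 1 ≤ b ^ n
  b^-pos = m^n>0 b

  2*b^≤b^suc : ∀ n → 2 * b ^ n ≤ b ^ suc n
  2*b^≤b^suc n = *-monoˡ-≤ (b ^ n) b≥2

  h-rec : ∀ L → h b (2 + L) ≡ b ^ L + h b L
  h-rec 0 = refl
  h-rec 1 = trans (cong suc (+-identityʳ (b ^ 1))) (+-comm 1 (b ^ 1))
  h-rec 2 = trans (cong suc (+-identityʳ (b ^ 2))) (+-comm 1 (b ^ 2))
  h-rec (suc (suc (suc k))) = begin
    1 + sum (map f (upTo (suc (suc (suc k) / 2))))  ≡⟨ cong (λ z → 1 + sum (map f (upTo (suc z)))) ⌊k+2⌋/2 ⟩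
    1 + sum (map f (upTo (suc (suc (k / 2)))))      ≡⟨ cong (1 +_) (sum-upTo-suc f g f∘suc≗g (suc (k / 2))) ⟩
    1 + (f 0 + sum (map g (upTo (suc (k / 2)))))    ≡⟨ swap (f 0) _ ⟩
    f 0 + (1 + sum (map g (upTo (suc (k / 2)))))    ∎
    where
    open ≡-Reasoning
    ⌊k+2⌋/2 : suc (suc k) / 2 ≡ suc (k / 2)
    ⌊k+2⌋/2 = m/n≡1+[m∸n]/n {suc (suc k)} {2} (s≤s (s≤s z≤n))
    f g : ℕ → ℕ
    f i = b ^ (5 + k ∸ 2 ∸ 2 * i)
    g i = b ^ (3 + k ∸ 2 ∸ 2 * i)
    f∘suc≗g : ∀ i → f (suc i) ≡ g i
    f∘suc≗g i = cong (λ z → b ^ (suc (suc k) ∸ z)) (+-suc i (i + 0))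
    swap : ∀ x y → 1 + (x + y) ≡ x + (1 + y)
    swap = solve-∀

  h-≤-suc : ∀ L → h b L ≤ h b (suc L)
  h-≤-suc 0 = z≤n
  h-≤-suc 1 = ≤-refl
  h-≤-suc (suc (suc L)) = subst₂ _≤_ (sym (h-rec L)) (sym (h-rec (suc L)))
    (+-mono-≤ (m≤n*m (b ^ L) b) (h-≤-suc L))

  h-suc-≤-b^ : ∀ L → h b (suc L) ≤ b ^ L
  h-suc-≤-b^ 0 = ≤-refl
  h-suc-≤-b^ 1 = b^-pos 1
  h-suc-≤-b^ (suc (suc L)) = begin
    h b (3 + L)               ≡⟨ h-rec (suc L) ⟩
    b ^ suc L + h b (suc L)   ≤⟨ +-monoʳ-≤ (b ^ suc L) (≤-trans (h-suc-≤-b^ L) (m≤n*m (b ^ L) b)) ⟩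
    b ^ suc L + b ^ suc L     ≡⟨ cong (b ^ suc L +_) (sym (+-identityʳ (b ^ suc L))) ⟩
    2 * b ^ suc L             ≤⟨ 2*b^≤b^suc (suc L) ⟩
    b ^ (2 + L)               ∎
    where open ≤-Reasoning

  h-≤-b^ : ∀ L → h b L ≤ b ^ L
  h-≤-b^ L = ≤-trans (h-≤-suc L) (h-suc-≤-b^ L)

  h[2+L]<⇒1≤L : ∀ L {w} → w < b ^ L → h b (2 + L) < suc w → 1 ≤ L
  h[2+L]<⇒1≤L zero    (s≤s z≤n) (s≤s ())
  h[2+L]<⇒1≤L (suc L) _ _ = s≤s z≤n

  <h[2+L]⇒1≤L : ∀ L {w} → suc w < h b (2 + L) → 1 ≤ L
  <h[2+L]⇒1≤L zero    (s≤s ())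
  <h[2+L]⇒1≤L (suc L) _ = s≤s z≤n

  gap : ℕ → ℕ
  gap L = h b (suc L) ∸ h b L

  h+gap : ∀ L → h b L + gap L ≡ h b (suc L)
  h+gap L = m+[n∸m]≡n (h-≤-suc L)

  gap-suc+gap : ∀ L → gap (suc L) + gap L ≡ b ^ L
  gap-suc+gap L = +-cancelʳ-≡ (h b L) _ _ (begin
    gap (suc L) + gap L + h b L      ≡⟨ regroup (gap (suc L)) (gap L) (h b L) ⟩
    (h b L + gap L) + gap (suc L)    ≡⟨ cong (_+ gap (suc L)) (h+gap L) ⟩
    h b (suc L) + gap (suc L)        ≡⟨ h+gap (suc L) ⟩
    h b (2 + L)                      ≡⟨ h-rec L ⟩
    b ^ L + h b L                    ∎)
    where
    open ≡-Reasoning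
    regroup : ∀ x y z → x + y + z ≡ (z + y) + x
    regroup = solve-∀

  gap-suc-≤-b^ : ∀ L → gap (suc L) ≤ b ^ L
  gap-suc-≤-b^ L = subst (gap (suc L) ≤_) (gap-suc+gap L) (m≤m+n (gap (suc L)) (gap L))

  2*gap-suc≤b^suc : ∀ L → 2 * gap (suc L) ≤ b ^ suc L
  2*gap-suc≤b^suc L = ≤-trans (*-monoʳ-≤ 2 (gap-suc-≤-b^ L)) (2*b^≤b^suc L)

  gap-suc-≤-suc : ∀ L → gap (suc L) ≤ gap (2 + L)
  gap-suc-≤-suc L = +-cancelʳ-≤ (gap (suc L)) _ _ (begin
    gap (suc L) + gap (suc L)   ≡⟨ cong (gap (suc L) +_) (sym (+-identityʳ (gap (suc L)))) ⟩
    2 * gap (suc L)             ≤⟨ 2*gap-suc≤b^suc L ⟩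
    b ^ suc L                   ≡⟨ sym (gap-suc+gap (suc L)) ⟩
    gap (2 + L) + gap (suc L)   ∎)
    where open ≤-Reasoning

  3*gap-suc≤gap-3+ : ∀ L → 3 * gap (suc L) ≤ gap (3 + L)
  3*gap-suc≤gap-3+ L = +-cancelʳ-≤ y _ _ (begin
    3 * x + y               ≡⟨ regroup x y ⟩
    2 * x + (y + x)         ≤⟨ +-monoˡ-≤ (y + x) (2*gap-suc≤b^suc L) ⟩
    b ^ suc L + (y + x)     ≡⟨ cong (b ^ suc L +_) (gap-suc+gap (suc L)) ⟩
    b ^ suc L + b ^ suc L   ≡⟨ cong (b ^ suc L +_) (sym (+-identityʳ (b ^ suc L))) ⟩
    2 * b ^ suc L           ≤⟨ 2*b^≤b^suc (suc L) ⟩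
    b ^ (2 + L)             ≡⟨ sym (gap-suc+gap (2 + L)) ⟩
    z + y                   ∎)
    where
    open ≤-Reasoning
    x = gap (suc L)
    y = gap (2 + L)
    z = gap (3 + L)
    regroup : ∀ x y → 3 * x + y ≡ 2 * x + (y + x)
    regroup = solve-∀

  gap-pos : ∀ L → 1 ≤ gap (2 + L)
  gap-pos zero    = ≤-trans (b^-pos 1) (≤-reflexive (sym (trans (cong (_∸ 1) (h-rec 1)) (m+n∸n≡m (b ^ 1) 1))))
  gap-pos (suc L) = ≤-trans (gap-pos L) (gap-suc-≤-suc (suc L))

  gap-suc-pos : ∀ {K} → 1 ≤ K → 1 ≤ gap (suc K)
  gap-suc-pos {suc K} _ = gap-pos K

  h-bracket : ∀ K w → suc w < h b K → ∃[ j ] (2 ≤ j × j < K × h b j ≤ suc w × suc w ≤ h b (suc j))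
  h-bracket zero          w ()
  h-bracket (suc zero)    w (s≤s ())
  h-bracket (suc (suc K)) w = bracket K
    where
    bracket : ∀ K → suc w < h b (2 + K) → ∃[ j ] (2 ≤ j × j < 2 + K × h b j ≤ suc w × suc w ≤ h b (suc j))
    bracket zero    (s≤s ())
    bracket (suc K) w+1<h with h b (2 + K) ≤? suc w
    ... | yes h≤ = 2 + K , s≤s (s≤s z≤n) , ≤-refl , h≤ , <⇒≤ w+1<h
    ... | no h≰ with bracket K (≰⇒> h≰)
    ...   | j , 2≤j , j< , h≤ , ≤h = j , 2≤j , m≤n⇒m≤1+n j< , h≤ , ≤h

  F*gap≤2*F*gap : ∀ n a x → F (n + suc a) * gap (suc x) ≤ 2 * F (suc a) * gap (n + suc x)
  F*gap≤2*F*gap zero a x = begin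
    F (suc a) * gap (suc x)                                  ≤⟨ m≤m+n _ _ ⟩
    F (suc a) * gap (suc x) + (F (suc a) * gap (suc x) + 0)  ≡⟨ sym (*-assoc 2 (F (suc a)) (gap (suc x))) ⟩
    2 * F (suc a) * gap (suc x)                              ∎
    where open ≤-Reasoning
  F*gap≤2*F*gap (suc zero) a x = *-mono-≤ (F-≤-2* a) (gap-suc-≤-suc x)
  F*gap≤2*F*gap (suc (suc n)) a x = begin
    F (2 + (n + suc a)) * gap (suc x)    ≡⟨ cong (λ k → F (2 + k) * gap (suc x)) (+-suc n a) ⟩
    F (3 + (n + a)) * gap (suc x)        ≤⟨ *-monoˡ-≤ (gap (suc x)) (F-≤-3* (n + a)) ⟩
    3 * F (suc (n + a)) * gap (suc x)    ≡⟨ cong (λ k → 3 * F k * gap (suc x)) (sym (+-suc n a)) ⟩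
    3 * F (n + suc a) * gap (suc x)      ≡⟨ *-assoc 3 (F (n + suc a)) (gap (suc x)) ⟩
    3 * (F (n + suc a) * gap (suc x))    ≤⟨ *-monoʳ-≤ 3 (F*gap≤2*F*gap n a x) ⟩
    3 * (2 * F (suc a) * gap (n + suc x))  ≡⟨ regroup (2 * F (suc a)) (gap (n + suc x)) ⟩
    2 * F (suc a) * (3 * gap (n + suc x))  ≡⟨ cong (λ k → 2 * F (suc a) * (3 * gap k)) (+-suc n x) ⟩
    2 * F (suc a) * (3 * gap (suc (n + x)))  ≤⟨ *-monoʳ-≤ (2 * F (suc a)) (3*gap-suc≤gap-3+ (n + x)) ⟩
    2 * F (suc a) * gap (3 + (n + x))    ≡⟨ cong (λ k → 2 * F (suc a) * gap (2 + k)) (sym (+-suc n x)) ⟩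
    2 * F (suc a) * gap (2 + (n + suc x))  ∎
    where
    open ≤-Reasoning
    regroup : ∀ y z → 3 * (y * z) ≡ y * (3 * z)
    regroup = solve-∀

  F*gap≤suc*F*gap : ∀ g i → F (suc g + (2 + i)) * gap (2 + i) ≤ suc g * F (suc i) * gap (2 + g + (2 + i))
  F*gap≤suc*F*gap zero i = begin
    F (3 + i) * gap (2 + i)            ≤⟨ *-monoˡ-≤ (gap (2 + i)) (F-≤-3* i) ⟩
    3 * F (suc i) * gap (2 + i)        ≡⟨ regroup (F (suc i)) (gap (2 + i)) ⟩
    1 * F (suc i) * (3 * gap (2 + i))  ≤⟨ *-monoʳ-≤ (1 * F (suc i)) (3*gap-suc≤gap-3+ (suc i)) ⟩
    1 * F (suc i) * gap (4 + i)        ∎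
    where
    open ≤-Reasoning
    regroup : ∀ x y → 3 * x * y ≡ 1 * x * (3 * y)
    regroup = solve-∀
  F*gap≤suc*F*gap (suc g) i = begin
    F (2 + g + (2 + i)) * gap (2 + i)                 ≡⟨ cong (λ k → F k * gap (2 + i)) (+-suc (2 + g) (suc i)) ⟩
    F (3 + g + suc i) * gap (2 + i)                   ≤⟨ F*gap≤2*F*gap (3 + g) i (suc i) ⟩
    2 * F (suc i) * gap (3 + g + (2 + i))
      ≤⟨ *-monoˡ-≤ (gap (3 + g + (2 + i))) (*-monoˡ-≤ (F (suc i)) (s≤s (s≤s (z≤n {g})))) ⟩
    suc (suc g) * F (suc i) * gap (3 + g + (2 + i))   ∎
    where open ≤-Reasoning

  peaks-below-line : ∀ g j K → K ≡ g + j → 2 ≤ j →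
    (F (2 + j) + g * F j) * gap (suc K) + F K * h b K ≤ F (2 + K) * gap (suc K) + F K * h b j
  peaks-below-line zero j .j refl _ =
    ≤-reflexive (cong (λ z → z * gap (suc j) + F j * h b j) (+-identityʳ (F (2 + j))))
  peaks-below-line (suc g) (suc zero) _ _ (s≤s ())
  peaks-below-line (suc g) (suc (suc i)) .(suc g + suc (suc i)) refl _ =
    +-cancelʳ-≤ c _ _ (begin
      (F (2 + j) + suc g * F j) * Dk + FK * h b K + c  ≡⟨ regroup (F (2 + j)) (F j) (F (suc i)) g Dk (FK * h b K) ⟩
      (F (3 + j) + g * F (suc j)) * Dk + FK * h b K    ≤⟨ peaks-below-line g (suc j) K (sym (+-suc g j)) (s≤s (s≤s z≤n)) ⟩
      F (2 + K) * Dk + FK * h b (suc j)                ≡⟨ cong (λ z → F (2 + K) * Dk + FK * z) (sym (h+gap j)) ⟩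
      F (2 + K) * Dk + FK * (h b j + gap j)            ≡⟨ distrib (F (2 + K) * Dk) FK (h b j) (gap j) ⟩
      F (2 + K) * Dk + FK * h b j + FK * gap j         ≤⟨ +-monoʳ-≤ (F (2 + K) * Dk + FK * h b j) (F*gap≤suc*F*gap g i) ⟩
      F (2 + K) * Dk + FK * h b j + c                  ∎)
    where
    open ≤-Reasoning
    j  = 2 + i
    K  = suc g + j
    Dk = gap (suc K)
    FK = F K
    c  = suc g * F (suc i) * Dk
    regroup : ∀ X Y Z g Dk W → (X + suc g * Y) * Dk + W + suc g * Z * Dk ≡ (X + (Y + Z) + g * (Y + Z)) * Dk + W
    regroup = solve-∀
    distrib : ∀ A B x y → A + B * (x + y) ≡ A + B * x + B * y
    distrib = solve-∀

count : ∀ {A : Set} {P : Pred A 0ℓ} → Decidable P → List A → ℕ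
count P? xs = length (filter P? xs)

module _ {A : Set} {P : Pred A 0ℓ} (P? : Decidable P) where

  count-++ : ∀ xs ys → count P? (xs ++ ys) ≡ count P? xs + count P? ys
  count-++ xs ys = trans (cong length (filter-++ P? xs ys)) (length-++ (filter P? xs))

  count-none : ∀ {xs} → All (∁ P) xs → count P? xs ≡ 0
  count-none ¬Ps = cong length (filter-none P? ¬Ps)

  count-cong : ∀ {Q : Pred A 0ℓ} (Q? : Decidable Q) {xs} → All (λ x → P x ⇔ Q x) xs → count P? xs ≡ count Q? xs
  count-cong Q? [] = refl
  count-cong Q? {x ∷ xs} (P⇔Q ∷ rest) with P? x | Q? x
  ... | yes _  | yes _  = cong suc (count-cong Q? rest)
  ... | yes Px | no ¬Qx = ⊥-elim (¬Qx (Equivalence.to P⇔Q Px))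
  ... | no ¬Px | yes Qx = ⊥-elim (¬Px (Equivalence.from P⇔Q Qx))
  ... | no _   | no _   = count-cong Q? rest

count-map : ∀ {A B : Set} {P : Pred B 0ℓ} (P? : Decidable P) (f : A → B) xs →
            count P? (map f xs) ≡ count (P? ∘ f) xs
count-map P? f [] = refl
count-map P? f (x ∷ xs) with does (P? (f x))
... | true  = cong suc (count-map P? f xs)
... | false = count-map P? f xs

sumBelow : ℕ → (ℕ → ℕ) → ℕ
sumBelow n g = sum (applyUpTo g n)

sumBelow-cong : ∀ n f g → (∀ i → i < n → f i ≡ g i) → sumBelow n f ≡ sumBelow n g
sumBelow-cong zero    f g f≗g = refl
sumBelow-cong (suc n) f g f≗g =
  cong₂ _+_ (f≗g 0 z<s) (sumBelow-cong n (f ∘ suc) (g ∘ suc) (λ i i<n → f≗g (suc i) (s<s i<n)))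

sumBelow-zero : ∀ n f → (∀ i → i < n → f i ≡ 0) → sumBelow n f ≡ 0
sumBelow-zero n f f≗0 = trans (sumBelow-cong n f (λ _ → 0) f≗0) (sum0 n)
  where
  sum0 : ∀ n → sumBelow n (λ _ → 0) ≡ 0
  sum0 zero    = refl
  sum0 (suc n) = sum0 n

sumBelow-linear : ∀ n f g p q → sumBelow n (λ i → f i * p + g i * q) ≡ sumBelow n f * p + sumBelow n g * q
sumBelow-linear zero    f g p q = refl
sumBelow-linear (suc n) f g p q = begin
  f 0 * p + g 0 * q + sumBelow n (λ i → f (suc i) * p + g (suc i) * q)
    ≡⟨ cong (f 0 * p + g 0 * q +_) (sumBelow-linear n (f ∘ suc) (g ∘ suc) p q) ⟩
  f 0 * p + g 0 * q + (sumBelow n (f ∘ suc) * p + sumBelow n (g ∘ suc) * q)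
    ≡⟨ regroup (f 0) (g 0) p q (sumBelow n (f ∘ suc)) (sumBelow n (g ∘ suc)) ⟩
  (f 0 + sumBelow n (f ∘ suc)) * p + (g 0 + sumBelow n (g ∘ suc)) * q  ∎
  where
  open ≡-Reasoning
  regroup : ∀ a c p q x y → a * p + c * q + (x * p + y * q) ≡ (a + x) * p + (c + y) * q
  regroup = solve-∀

sumBelow-single : ∀ n f i₀ → i₀ < n → (∀ i → i < n → i ≢ i₀ → f i ≡ 0) → sumBelow n f ≡ f i₀
sumBelow-single (suc n) f zero _ f≗0 =
  trans (cong (f 0 +_) (sumBelow-zero n (f ∘ suc) (λ i i<n → f≗0 (suc i) (s<s i<n) λ ())))
        (+-identityʳ (f 0))
sumBelow-single (suc n) f (suc i₀) (s<s i₀<n) f≗0 =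
  trans (cong (_+ sumBelow n (f ∘ suc)) (f≗0 0 z<s λ ()))
        (sumBelow-single n (f ∘ suc) i₀ i₀<n (λ i i<n i≢i₀ → f≗0 (suc i) (s<s i<n) (i≢i₀ ∘ suc-injective)))

count-concatMap : ∀ {A B : Set} {P : Pred B 0ℓ} (P? : Decidable P) (g : A → List B) (k : ℕ → A) n →
                  count P? (concatMap g (applyUpTo k n)) ≡ sumBelow n (λ i → count P? (g (k i)))
count-concatMap P? g k zero    = refl
count-concatMap P? g k (suc n) =
  trans (count-++ P? (g (k 0)) _) (cong (count P? (g (k 0)) +_) (count-concatMap P? g (k ∘ suc) n))

-- The effect of a new leading digit d on the pair (ways L w , ways L (b ^ L + w)).
step : ℕ → ℕ × ℕ → ℕ × ℕ
step 0             (p , q) = p , p + q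
step 1             (p , q) = p + q , q
step (suc (suc _)) (p , q) = p + q , 0

module Expansions (b' : ℕ) where

  open Gaps b' using (b; b≥2; b^-pos)

  ways : ℕ → ℕ → ℕ
  ways L N = count (λ w → value b w ≟ N) (words b L)

  value-foldl : ∀ x w → foldl (λ x d → x * b + d) x w ≡ x * b ^ length w + value b w
  value-foldl x [] = sym (trans (cong (_+ 0) (*-identityʳ x)) (+-identityʳ x))
  value-foldl x (d ∷ w) = begin
    foldl _ (x * b + d) w                                ≡⟨ value-foldl (x * b + d) w ⟩
    (x * b + d) * b ^ length w + value b w               ≡⟨ regroup x b d (b ^ length w) (value b w) ⟩
    x * (b * b ^ length w) + (d * b ^ length w + value b w)  ≡⟨ cong (x * (b * b ^ length w) +_) (sym (value-foldl d w)) ⟩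
    x * (b * b ^ length w) + foldl _ d w                 ∎
    where
    open ≡-Reasoning
    regroup : ∀ a b x B R → (a * b + x) * B + R ≡ a * (b * B) + (x * B + R)
    regroup = solve-∀

  value-∷ : ∀ d w → value b (d ∷ w) ≡ d * b ^ length w + value b w
  value-∷ = value-foldl

  words-length : ∀ L → All (λ w → length w ≡ L) (words b L)
  words-length zero    = refl ∷ []
  words-length (suc L) =
    concat⁺ (map⁺ (All.universal (λ d → map⁺ (All.map (cong suc) (words-length L))) (upTo (suc b))))

  digitTerm : (ℕ → ℕ) → ℕ → ℕ → ℕ → ℕ
  digitTerm f L N d with d * b ^ L ≤? N
  ... | yes _ = f (N ∸ d * b ^ L)
  ... | no _  = 0

  digitTerm-≤ : ∀ f L N d → d * b ^ L ≤ N → digitTerm f L N d ≡ f (N ∸ d * b ^ L)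
  digitTerm-≤ f L N d d*b^L≤N with d * b ^ L ≤? N
  ... | yes _ = refl
  ... | no ≰  = ⊥-elim (≰ d*b^L≤N)

  digitTerm-> : ∀ f L N d → N < d * b ^ L → digitTerm f L N d ≡ 0
  digitTerm-> f L N d N<d*b^L with d * b ^ L ≤? N
  ... | yes ≤ = ⊥-elim (<⇒≱ N<d*b^L ≤)
  ... | no _  = refl

  count-leading : ∀ L N d → count (λ w → value b (d ∷ w) ≟ N) (words b L) ≡ digitTerm (ways L) L N d
  count-leading L N d with d * b ^ L ≤? N
  ... | yes d*b^L≤N = count-cong _ _ (All.map (λ {w} ∣w∣≡L → mk⇔ (to w ∣w∣≡L) (from w ∣w∣≡L)) (words-length L))
    where
    value-∷-L : ∀ w → length w ≡ L → value b (d ∷ w) ≡ d * b ^ L + value b w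
    value-∷-L w ∣w∣≡L = trans (value-∷ d w) (cong (λ l → d * b ^ l + value b w) ∣w∣≡L)
    to : ∀ w → length w ≡ L → value b (d ∷ w) ≡ N → value b w ≡ N ∸ d * b ^ L
    to w ∣w∣≡L eq = sym (trans (cong (_∸ d * b ^ L) (trans (sym eq) (value-∷-L w ∣w∣≡L)))
                               (m+n∸m≡n (d * b ^ L) (value b w)))
    from : ∀ w → length w ≡ L → value b w ≡ N ∸ d * b ^ L → value b (d ∷ w) ≡ N
    from w ∣w∣≡L eq = trans (value-∷-L w ∣w∣≡L) (trans (cong (d * b ^ L +_) eq) (m+[n∸m]≡n d*b^L≤N))
  ... | no d*b^L≰N = count-none _ (All.map (λ {w} ∣w∣≡L eq → d*b^L≰N (begin
      d * b ^ L                ≤⟨ m≤m+n _ _ ⟩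
      d * b ^ L + value b w    ≡⟨ cong (λ l → d * b ^ l + value b w) (sym ∣w∣≡L) ⟩
      d * b ^ length w + value b w  ≡⟨ sym (value-∷ d w) ⟩
      value b (d ∷ w)          ≡⟨ eq ⟩
      N                        ∎)) (words-length L))
    where open ≤-Reasoning

  ways-suc : ∀ L N → ways (suc L) N ≡ sumBelow (suc b) (digitTerm (ways L) L N)
  ways-suc L N = trans (count-concatMap value≟N (λ d → map (d ∷_) (words b L)) (λ d → d) (suc b))
    (sumBelow-cong (suc b) _ _ λ d _ → trans (count-map value≟N (d ∷_) (words b L)) (count-leading L N d))
    where
    value≟N = λ w → value b w ≟ N

  -- A word of length L has value at most b (b ^ L - 1) / (b - 1) ≤ 2 b ^ L - 2.
  ways-vanish : ∀ L N → 2 * b ^ L ≤ suc N → ways L N ≡ 0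
  ways-vanish zero zero (s≤s ())
  ways-vanish zero (suc N) _ = refl
  ways-vanish (suc L) N 2*b^L+1≤N+1 = trans (ways-suc L N) (sumBelow-zero (suc b) _ term≡0)
    where
    term≡0 : ∀ d → d < suc b → digitTerm (ways L) L N d ≡ 0
    term≡0 d (s≤s d≤b) with d * b ^ L ≤? N
    ... | no _ = refl
    ... | yes d*b^L≤N = ways-vanish L (N ∸ d * b ^ L) (begin
      2 * b ^ L                        ≡⟨ sym (m+n∸n≡m (2 * b ^ L) (d * b ^ L)) ⟩
      2 * b ^ L + d * b ^ L ∸ d * b ^ L  ≤⟨ ∸-monoˡ-≤ (d * b ^ L) (begin
        2 * b ^ L + d * b ^ L            ≤⟨ +-mono-≤ (*-monoˡ-≤ (b ^ L) b≥2) (*-monoˡ-≤ (b ^ L) d≤b) ⟩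
        b * b ^ L + b * b ^ L            ≡⟨ cong (b * b ^ L +_) (sym (+-identityʳ (b * b ^ L))) ⟩
        2 * (b * b ^ L)                  ≤⟨ 2*b^L+1≤N+1 ⟩
        suc N                            ∎) ⟩
      suc N ∸ d * b ^ L                ≡⟨ +-∸-assoc 1 d*b^L≤N ⟩
      suc (N ∸ d * b ^ L)              ∎)
      where open ≤-Reasoning

  ways-suc-small : ∀ L N → N < b ^ L → ways (suc L) N ≡ ways L N
  ways-suc-small L N N<b^L = begin
    ways (suc L) N                                          ≡⟨ ways-suc L N ⟩
    digitTerm (ways L) L N 0 + sumBelow b (digitTerm (ways L) L N ∘ suc)
      ≡⟨ cong₂ _+_ (digitTerm-≤ (ways L) L N 0 z≤n) (sumBelow-zero b _ λ d _ →
           digitTerm-> (ways L) L N (suc d) (<-≤-trans N<b^L (m≤m+n (b ^ L) (d * b ^ L)))) ⟩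
    ways L N + 0                                            ≡⟨ +-identityʳ _ ⟩
    ways L N                                                ∎
    where open ≡-Reasoning

  ways-+-small : ∀ k L N → N < b ^ L → ways (k + L) N ≡ ways L N
  ways-+-small zero    L N N<b^L = refl
  ways-+-small (suc k) L N N<b^L =
    trans (ways-suc-small (k + L) N (<-≤-trans N<b^L (^-monoʳ-≤ b (m≤n+m L k)))) (ways-+-small k L N N<b^L)

  ways-zero : ∀ L → ways L 0 ≡ 1
  ways-zero zero    = refl
  ways-zero (suc L) = trans (ways-suc-small L 0 (b^-pos L)) (ways-zero L)

  n<b^n : ∀ n → n < b ^ n
  n<b^n zero    = s≤s z≤n
  n<b^n (suc n) = begin-strict
    suc n          <⟨ s≤s (n<b^n n) ⟩
    suc (b ^ n)    ≤⟨ +-monoˡ-≤ (b ^ n) (b^-pos n) ⟩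
    b ^ n + b ^ n  ≡⟨ cong (b ^ n +_) (sym (+-identityʳ (b ^ n))) ⟩
    2 * b ^ n      ≤⟨ *-monoˡ-≤ (b ^ n) b≥2 ⟩
    b * b ^ n      ∎
    where open ≤-Reasoning

  ways-stable : ∀ L N → N < b ^ L → ways L N ≡ ways N N
  ways-stable L N N<b^L with ≤-total L N
  ... | inj₁ L≤N = sym (trans (cong (λ l → ways l N) (sym (m∸n+n≡m L≤N))) (ways-+-small (N ∸ L) L N N<b^L))
  ... | inj₂ N≤L = trans (cong (λ l → ways l N) (sym (m∸n+n≡m N≤L))) (ways-+-small (L ∸ N) N N (n<b^n N))

  digitTerm-ways0-≢ : ∀ a d → d ≢ a → digitTerm (ways 0) 0 a d ≡ 0
  digitTerm-ways0-≢ a d d≢a with d * b ^ 0 ≤? a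
  ... | no _ = refl
  ... | yes d*1≤a = ways0-pos (m<n⇒0<n∸m (≤∧≢⇒< d*1≤a λ d*1≡a → d≢a (trans (sym (*-identityʳ d)) d*1≡a)))
    where
    ways0-pos : ∀ {N} → 0 < N → ways 0 N ≡ 0
    ways0-pos {suc N} _ = refl

  ways-one-≤ : ∀ a → a ≤ b → ways 1 a ≡ 1
  ways-one-≤ a a≤b = begin
    ways 1 a                          ≡⟨ ways-suc 0 a ⟩
    sumBelow (suc b) (digitTerm (ways 0) 0 a)  ≡⟨ sumBelow-single (suc b) _ a (s≤s a≤b) (λ d _ → digitTerm-ways0-≢ a d) ⟩
    digitTerm (ways 0) 0 a a          ≡⟨ digitTerm-≤ (ways 0) 0 a a (≤-reflexive (*-identityʳ a)) ⟩
    ways 0 (a ∸ a * 1)                ≡⟨ cong (ways 0) (trans (cong (a ∸_) (*-identityʳ a)) (n∸n≡0 a)) ⟩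
    1                                 ∎
    where open ≡-Reasoning

  ways-one-> : ∀ a → b < a → ways 1 a ≡ 0
  ways-one-> a b<a = trans (ways-suc 0 a) (sumBelow-zero (suc b) _ λ d d<1+b →
    digitTerm-ways0-≢ a d λ d≡a → <-irrefl d≡a (≤-<-trans (≤-pred d<1+b) b<a))

  -- ways T (a - 1), except that it vanishes at a = 0 (truncated subtraction would give ways T 0 = 1)
  ways-pred : ℕ → ℕ → ℕ
  ways-pred T zero    = 0
  ways-pred T (suc a) = ways T a

  sumBelow-digitTerm-ways-pred : ∀ T a → sumBelow (suc b) (digitTerm (ways-pred T) T a) ≡ ways-pred (suc T) a
  sumBelow-digitTerm-ways-pred T zero = sumBelow-zero (suc b) _ term≡0
    where
    term≡0 : ∀ d → d < suc b → digitTerm (ways-pred T) T 0 d ≡ 0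
    term≡0 d _ with d * b ^ T ≤? 0
    ... | yes _ = cong (ways-pred T) (0∸n≡0 (d * b ^ T))
    ... | no _  = refl
  sumBelow-digitTerm-ways-pred T (suc a) = trans (sumBelow-cong (suc b) _ _ term≡) (sym (ways-suc T a))
    where
    term≡ : ∀ d → d < suc b → digitTerm (ways-pred T) T (suc a) d ≡ digitTerm (ways T) T a d
    term≡ d _ with d * b ^ T ≤? a
    ... | yes d*b^T≤a = trans (digitTerm-≤ (ways-pred T) T (suc a) d (m≤n⇒m≤1+n d*b^T≤a))
                              (cong (ways-pred T) (+-∸-assoc 1 d*b^T≤a))
    ... | no d*b^T≰a with d * b ^ T ≤? suc a
    ...   | no _  = refl
    ...   | yes d*b^T≤1+a =
      cong (ways-pred T) (subst (λ x → suc a ∸ x ≡ 0) (sym (≤-antisym d*b^T≤1+a (≰⇒> d*b^T≰a))) (n∸n≡0 (suc a)))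

  [a*B+w]∸c*B≡[a∸c]*B+w : ∀ a c B w → c ≤ a → a * B + w ∸ c * B ≡ (a ∸ c) * B + w
  [a*B+w]∸c*B≡[a∸c]*B+w a c B w c≤a = begin
    a * B + w ∸ c * B                ≡⟨ cong (λ x → x * B + w ∸ c * B) (sym (m∸n+n≡m c≤a)) ⟩
    (a ∸ c + c) * B + w ∸ c * B      ≡⟨ cong (_∸ c * B) (regroup (a ∸ c) c B w) ⟩
    (a ∸ c) * B + w + c * B ∸ c * B  ≡⟨ m+n∸n≡m _ (c * B) ⟩
    (a ∸ c) * B + w                  ∎
    where
    open ≡-Reasoning
    regroup : ∀ d c B w → (d + c) * B + w ≡ d * B + w + c * B
    regroup = solve-∀

  -- Split a word of length T + L into its top T and bottom L digits: the bottom part has value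
  -- w, or b ^ L + w with a carry of one into the top part.
  ways-split : ∀ T L a w → w < b ^ L →
               ways (T + L) (a * b ^ L + w) ≡ ways T a * ways L w + ways-pred T a * ways L (b ^ L + w)
  ways-split zero L zero w _ = solve (ways L w) (ways L (b ^ L + w))
    where
    solve : ∀ p q → p ≡ 1 * p + 0 * q
    solve = solve-∀
  ways-split zero L 1 w _ = trans (cong (λ x → ways L (x + w)) (*-identityˡ (b ^ L))) (solve (ways L w) (ways L (b ^ L + w)))
    where
    solve : ∀ p q → q ≡ 0 * p + 1 * q
    solve = solve-∀
  ways-split zero L (suc (suc a)) w _ =
    ways-vanish L _ (≤-trans (*-monoˡ-≤ (b ^ L) (s≤s (s≤s (z≤n {a})))) (≤-trans (m≤m+n _ w) (n≤1+n _)))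
  ways-split (suc T) L a w w<b^L = begin
    ways (suc (T + L)) X                                          ≡⟨ ways-suc (T + L) X ⟩
    sumBelow (suc b) (digitTerm (ways (T + L)) (T + L) X)         ≡⟨ sumBelow-cong (suc b) _ _ (λ d _ → term≡ d) ⟩
    sumBelow (suc b) (λ d → digitTerm (ways T) T a d * p + digitTerm (ways-pred T) T a d * q)
      ≡⟨ sumBelow-linear (suc b) (digitTerm (ways T) T a) (digitTerm (ways-pred T) T a) p q ⟩
    sumBelow (suc b) (digitTerm (ways T) T a) * p + sumBelow (suc b) (digitTerm (ways-pred T) T a) * q
      ≡⟨ cong₂ (λ x y → x * p + y * q) (sym (ways-suc T a)) (sumBelow-digitTerm-ways-pred T a) ⟩
    ways (suc T) a * p + ways-pred (suc T) a * q                  ∎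
    where
    open ≡-Reasoning
    X = a * b ^ L + w
    p = ways L w
    q = ways L (b ^ L + w)
    d*b^[T+L] : ∀ d → d * b ^ (T + L) ≡ d * b ^ T * b ^ L
    d*b^[T+L] d = trans (cong (d *_) (^-distribˡ-+-* b T L)) (sym (*-assoc d (b ^ T) (b ^ L)))
    term≡ : ∀ d → digitTerm (ways (T + L)) (T + L) X d ≡ digitTerm (ways T) T a d * p + digitTerm (ways-pred T) T a d * q
    term≡ d with d * b ^ T ≤? a
    ... | yes d*b^T≤a = begin
      digitTerm (ways (T + L)) (T + L) X d
        ≡⟨ digitTerm-≤ (ways (T + L)) (T + L) X d d*b^[T+L]≤X ⟩
      ways (T + L) (X ∸ d * b ^ (T + L))
        ≡⟨ cong (ways (T + L)) (trans (cong (X ∸_) (d*b^[T+L] d)) ([a*B+w]∸c*B≡[a∸c]*B+w a (d * b ^ T) (b ^ L) w d*b^T≤a)) ⟩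
      ways (T + L) ((a ∸ d * b ^ T) * b ^ L + w)
        ≡⟨ ways-split T L (a ∸ d * b ^ T) w w<b^L ⟩
      ways T (a ∸ d * b ^ T) * p + ways-pred T (a ∸ d * b ^ T) * q  ∎
      where
      d*b^[T+L]≤X : d * b ^ (T + L) ≤ X
      d*b^[T+L]≤X = ≤-trans (≤-reflexive (d*b^[T+L] d)) (≤-trans (*-monoˡ-≤ (b ^ L) d*b^T≤a) (m≤m+n _ w))
    ... | no d*b^T≰a = digitTerm-> (ways (T + L)) (T + L) X d
      (subst (X <_) (sym (d*b^[T+L] d)) (a*B+w<c*B w<b^L (≰⇒> d*b^T≰a)))

  waysPair : ℕ → ℕ → ℕ × ℕ
  waysPair L w = ways L w , ways L (b ^ L + w)

  waysPair-step : ∀ L d w → d < b → w < b ^ L → waysPair (suc L) (d * b ^ L + w) ≡ step d (waysPair L w)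
  waysPair-step L d w d<b w<b^L = cong₂ _,_ (trans (low d) (lowDigit d d<b)) (trans high (highDigit d d<b))
    where
    p = ways L w
    q = ways L (b ^ L + w)
    low : ∀ a → ways (suc L) (a * b ^ L + w) ≡ ways 1 a * p + ways-pred 1 a * q
    low a = ways-split 1 L a w w<b^L
    carry : b ^ suc L + (d * b ^ L + w) ≡ (b + d) * b ^ L + w
    carry = regroup b (b ^ L) d w
      where
      regroup : ∀ b B d w → b * B + (d * B + w) ≡ (b + d) * B + w
      regroup = solve-∀
    high : ways (suc L) (b ^ suc L + (d * b ^ L + w)) ≡ ways 1 (b + d) * p + ways-pred 1 (b + d) * q
    high = trans (cong (ways (suc L)) carry) (low (b + d))
    1p+0q : 1 * p + 0 * q ≡ p
    1p+0q = trans (+-identityʳ (1 * p)) (*-identityˡ p)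
    1p+1q : 1 * p + 1 * q ≡ p + q
    1p+1q = cong₂ _+_ (*-identityˡ p) (*-identityˡ q)
    0p+1q : 0 * p + 1 * q ≡ q
    0p+1q = *-identityˡ q
    lowDigit : ∀ d → d < b → ways 1 d * p + ways-pred 1 d * q ≡ proj₁ (step d (p , q))
    lowDigit zero _ = trans (cong (λ x → x * p + 0 * q) (ways-one-≤ 0 z≤n)) 1p+0q
    lowDigit (suc d) d<b = trans (cong₂ (λ x y → x * p + y * q) (ways-one-≤ (suc d) (<⇒≤ d<b))
                                        (ways-one-≤ d (≤-trans (n≤1+n d) (<⇒≤ d<b))))
                                 (trans 1p+1q (sym (step-suc d)))
      where
      step-suc : ∀ d → proj₁ (step (suc d) (p , q)) ≡ p + q
      step-suc zero    = refl
      step-suc (suc d) = refl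
    highDigit : ∀ d → d < b → ways 1 (b + d) * p + ways-pred 1 (b + d) * q ≡ proj₂ (step d (p , q))
    highDigit zero _ = trans (cong₂ (λ x y → x * p + y * q) (ways-one-≤ (b + 0) (≤-reflexive (+-identityʳ b)))
                                    (ways-one-≤ (suc (b' + 0)) (s≤s (≤-trans (≤-reflexive (+-identityʳ b')) (n≤1+n b')))))
                             1p+1q
    highDigit 1 _ = trans (cong₂ (λ x y → x * p + y * q) (ways-one-> (b + 1) (m<m+n b z<s))
                                 (ways-one-≤ (suc (b' + 1)) (≤-reflexive (cong suc (+-comm b' 1)))))
                          0p+1q
    highDigit (suc (suc d)) _ = cong₂ (λ x y → x * p + y * q) (ways-one-> (b + suc (suc d)) (m<m+n b z<s))
                                      (ways-one-> (suc (b' + suc (suc d)))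
                                        (s≤s (≤-trans (≤-reflexive (+-comm 2 b')) (+-monoʳ-≤ b' (s≤s (s≤s z≤n))))))

  overExp? : ∀ N → Decidable (λ w → isOverExp b N w ≡ true)
  overExp? N w = isOverExp b N w Data.Bool.≟ true

  count-overExp-words : ∀ L N → count (overExp? N) (words b (suc L)) + ways L N ≡ ways (suc L) N
  count-overExp-words L N = begin
    count (overExp? N) (words b (suc L)) + ways L N     ≡⟨ cong (_+ ways L N) overExps ⟩
    sumBelow b leading + ways L N                       ≡⟨ +-comm (sumBelow b leading) (ways L N) ⟩
    ways L N + sumBelow b leading                       ≡⟨ sym allWords ⟩
    ways (suc L) N                                      ∎
    where
    open ≡-Reasoning
    value≟N = λ w → value b w ≟ N
    leading : ℕ → ℕ
    leading i = count (λ w → value b (suc i ∷ w) ≟ N) (words b L)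
    byDigit : ∀ {P : Pred (List ℕ) 0ℓ} (P? : Decidable P) →
              count P? (words b (suc L)) ≡ sumBelow (suc b) (λ d → count (P? ∘ (d ∷_)) (words b L))
    byDigit P? = trans (count-concatMap P? (λ d → map (d ∷_) (words b L)) (λ d → d) (suc b))
                       (sumBelow-cong (suc b) _ _ λ d _ → count-map P? (d ∷_) (words b L))
    overExps : count (overExp? N) (words b (suc L)) ≡ sumBelow b leading
    overExps = trans (byDigit (overExp? N)) (cong₂ _+_ leadingZero (sumBelow-cong b _ leading leadingNonzero))
      where
      leadingZero : count (overExp? N ∘ (0 ∷_)) (words b L) ≡ 0
      leadingZero = count-none (overExp? N ∘ (0 ∷_)) (All.universal (λ w ()) (words b L))
      leadingNonzero : ∀ i → i < b → count (overExp? N ∘ (suc i ∷_)) (words b L) ≡ leading i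
      leadingNonzero i _ = count-cong (overExp? N ∘ (suc i ∷_)) (λ w → value b (suc i ∷ w) ≟ N)
        (All.universal (λ w → ⌊≟⌋≡true⇔≡ (value b (suc i ∷ w)) N) (words b L))
    allWords : ways (suc L) N ≡ ways L N + sumBelow b leading
    allWords = byDigit value≟N

  count-overExp-wordsUpTo : ∀ M N → count (overExp? N) (wordsUpTo b M) + ways 0 N ≡ ways M N
  count-overExp-wordsUpTo zero    N = refl
  count-overExp-wordsUpTo (suc M) N = begin
    count (overExp? N) (words b (suc M) ++ wordsUpTo b M) + ways 0 N
      ≡⟨ cong (_+ ways 0 N) (count-++ (overExp? N) (words b (suc M)) (wordsUpTo b M)) ⟩
    count (overExp? N) (words b (suc M)) + count (overExp? N) (wordsUpTo b M) + ways 0 N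
      ≡⟨ +-assoc (count (overExp? N) (words b (suc M))) _ _ ⟩
    count (overExp? N) (words b (suc M)) + (count (overExp? N) (wordsUpTo b M) + ways 0 N)
      ≡⟨ cong (count (overExp? N) (words b (suc M)) +_) (count-overExp-wordsUpTo M N) ⟩
    count (overExp? N) (words b (suc M)) + ways M N
      ≡⟨ count-overExp-words M N ⟩
    ways (suc M) N  ∎
    where open ≡-Reasoning

  s-suc≡ways : ∀ L N → N < b ^ L → s b (suc N) ≡ ways L N
  s-suc≡ways L zero    _      = sym (ways-zero L)
  s-suc≡ways L (suc n) n<b^L = begin
    overExpCount b (suc n)            ≡⟨ sym (+-identityʳ _) ⟩
    overExpCount b (suc n) + 0        ≡⟨ count-overExp-wordsUpTo (2 + n) (suc n) ⟩
    ways (2 + n) (suc n)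
      ≡⟨ ways-stable (2 + n) (suc n) (<-≤-trans (n<b^n (suc n)) (^-monoʳ-≤ b (n≤1+n (suc n)))) ⟩
    ways (suc n) (suc n)              ≡⟨ sym (ways-stable L (suc n) n<b^L) ⟩
    ways L (suc n)                    ∎
    where open ≡-Reasoning

  s-split : ∀ L a w → w < b ^ L → s b (suc (a * b ^ L + w)) ≡ s b (suc a) * ways L w + s b a * ways L (b ^ L + w)
  s-split L a w w<b^L = begin
    s b (suc X)                                   ≡⟨ s-suc≡ways (T + L) X X<b^[T+L] ⟩
    ways (T + L) X                                ≡⟨ ways-split T L a w w<b^L ⟩
    ways T a * ways L w + ways-pred T a * ways L (b ^ L + w)
      ≡⟨ cong₂ (λ x y → x * ways L w + y * ways L (b ^ L + w)) (sym (s-suc≡ways T a a<b^T)) (ways-pred≡s a a<b^T) ⟩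
    s b (suc a) * ways L w + s b a * ways L (b ^ L + w)  ∎
    where
    open ≡-Reasoning
    X = a * b ^ L + w
    T = suc X
    X<b^T : X < b ^ T
    X<b^T = <-trans (n<1+n X) (n<b^n T)
    X<b^[T+L] : X < b ^ (T + L)
    X<b^[T+L] = <-≤-trans X<b^T (^-monoʳ-≤ b (m≤m+n T L))
    a<b^T : a < b ^ T
    a<b^T = ≤-<-trans (≤-trans (m≤m*n a (b ^ L) {{>-nonZero (b^-pos L)}}) (m≤m+n (a * b ^ L) w)) X<b^T
    ways-pred≡s : ∀ a → a < b ^ T → ways-pred T a ≡ s b a
    ways-pred≡s zero     _       = refl
    ways-pred≡s (suc a′) a<b^T′ = sym (s-suc≡ways T a′ (<-trans (n<1+n a′) a<b^T′))

module Bounds (b' : ℕ) (R : ℕ → ℕ → ℕ × ℕ) (R-base : R 0 0 ≡ (1 , 0))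
  (R-step : ∀ L d w → d < 2 + b' → w < (2 + b') ^ L → R (suc L) (d * (2 + b') ^ L + w) ≡ step d (R L w)) where

  open Gaps b'

  R₁ R₂ : ℕ → ℕ → ℕ
  R₁ L w = proj₁ (R L w)
  R₂ L w = proj₂ (R L w)

  data LeadingDigit (L u : ℕ) : Set where
    leading : ∀ d w → d < b → w < b ^ L → u ≡ d * b ^ L + w → R (suc L) u ≡ step d (R L w) → LeadingDigit L u

  leadingDigit : ∀ L u → u < b ^ suc L → LeadingDigit L u
  leadingDigit L u u<b^[1+L] = leading d w d<b w<B u≡d*B+w (trans (cong (R (suc L)) u≡d*B+w) (R-step L d w d<b w<B))
    where
    B = b ^ L
    instance
      B≢0 : NonZero B
      B≢0 = >-nonZero (b^-pos L)
    d = u / B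
    w = u % B
    w<B : w < B
    w<B = m%n<n u B
    u≡d*B+w : u ≡ d * B + w
    u≡d*B+w = trans (m≡m%n+[m/n]*n u B) (+-comm w (d * B))
    d<b : d < b
    d<b = *-cancelʳ-< B d b (≤-<-trans (≤-trans (m≤m+n (d * B) w) (≤-reflexive (sym u≡d*B+w))) u<b^[1+L])

  R-level0 : ∀ w → w < 1 → R 0 w ≡ (1 , 0)
  R-level0 zero _ = R-base
  R-level0 (suc w) (s≤s ())

  R-level1 : ∀ w → w < b → R 1 w ≡ step w (1 , 0)
  R-level1 w w<b = trans (cong (R 1) (sym (trans (+-identityʳ (w * 1)) (*-identityʳ w))))
                         (trans (R-step 0 w 0 w<b z<s) (cong (step w) R-base))

  R-step0 : ∀ L w → w < b ^ L → R (suc L) w ≡ step 0 (R L w)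
  R-step0 L w = R-step L 0 w z<s

  R-zeros : ∀ i j w → w < b ^ j → R (i + j) w ≡ (R₁ j w , R₂ j w + i * R₁ j w)
  R-zeros zero    j w _      = cong (R₁ j w ,_) (sym (+-identityʳ (R₂ j w)))
  R-zeros (suc i) j w w<b^j = begin
    R (suc (i + j)) w                        ≡⟨ R-step0 (i + j) w (<-≤-trans w<b^j (^-monoʳ-≤ b (m≤n+m j i))) ⟩
    step 0 (R (i + j) w)                     ≡⟨ cong (step 0) (R-zeros i j w w<b^j) ⟩
    (R₁ j w , R₁ j w + (R₂ j w + i * R₁ j w))  ≡⟨ cong (R₁ j w ,_) (regroup (R₁ j w) (R₂ j w) i) ⟩
    (R₁ j w , R₂ j w + suc i * R₁ j w)       ∎
    where
    open ≡-Reasoning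
    regroup : ∀ p q i → p + (q + i * p) ≡ q + suc i * p
    regroup = solve-∀

  Bounded : ℕ → ℕ × ℕ → Set
  Bounded L (p , q) = p ≤ F (suc L) × q ≤ F (suc L) × p + q ≤ F (2 + L)

  step-bounded : ∀ L d v → Bounded L v → Bounded (suc L) (step d v)
  step-bounded L 0 (p , q) (p≤ , q≤ , p+q≤) =
    ≤-trans p≤ (F-≤-suc (suc L)) , p+q≤ , subst (_≤ F (3 + L)) (+-comm (p + q) p) (+-mono-≤ p+q≤ p≤)
  step-bounded L 1 (p , q) (p≤ , q≤ , p+q≤) = p+q≤ , ≤-trans q≤ (F-≤-suc (suc L)) , +-mono-≤ p+q≤ q≤
  step-bounded L (suc (suc d)) (p , q) (p≤ , q≤ , p+q≤) =
    p+q≤ , z≤n , ≤-trans (≤-reflexive (+-identityʳ (p + q))) (≤-trans p+q≤ (F-≤-suc (2 + L)))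

  R-bounded : ∀ L w → w < b ^ L → Bounded L (R L w)
  R-bounded zero w w<1 rewrite R-level0 w w<1 = ≤-refl , z≤n , ≤-refl
  R-bounded (suc L) u u<b^[1+L] with leadingDigit L u u<b^[1+L]
  ... | leading d w _ w<b^L _ R≡ rewrite R≡ = step-bounded L d (R L w) (R-bounded L w w<b^L)

  bounded-linearʳ : ∀ L p q α δ → Bounded L (p , q) → α * p + (α + δ) * q ≤ α * F L + (α + δ) * F (suc L)
  bounded-linearʳ L p q α δ (_ , q≤ , p+q≤) = begin
    α * p + (α + δ) * q                       ≡⟨ regroup α δ p q ⟩
    α * (p + q) + δ * q                       ≤⟨ +-mono-≤ (*-monoʳ-≤ α p+q≤) (*-monoʳ-≤ δ q≤) ⟩
    α * (F (suc L) + F L) + δ * F (suc L)     ≡⟨ regroup′ α δ (F (suc L)) (F L) ⟩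
    α * F L + (α + δ) * F (suc L)             ∎
    where
    open ≤-Reasoning
    regroup : ∀ α δ p q → α * p + (α + δ) * q ≡ α * (p + q) + δ * q
    regroup = solve-∀
    regroup′ : ∀ α δ x y → α * (x + y) + δ * x ≡ α * y + (α + δ) * x
    regroup′ = solve-∀

  bounded-linearˡ : ∀ L p q α δ → Bounded L (p , q) → (α + δ) * p + α * q ≤ (α + δ) * F (suc L) + α * F L
  bounded-linearˡ L p q α δ (p≤ , q≤ , p+q≤) =
    subst₂ _≤_ (+-comm (α * q) ((α + δ) * p)) (+-comm (α * F L) ((α + δ) * F (suc L)))
      (bounded-linearʳ L q p α δ (q≤ , p≤ , subst (_≤ F (2 + L)) (+-comm p q) p+q≤))

  weight : ℕ → ℕ × ℕ → ℕ
  weight j (p , q) = F j * p + F (suc j) * q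

  weight-step≥2 : ∀ L j k d p q → k ≡ 2 + L + j → 2 ≤ j → Bounded (suc L) (p , q) →
                  weight j (step (2 + d) (p , q)) < F (suc k)
  weight-step≥2 L j k d p q k≡ 2≤j (_ , _ , p+q≤) = begin-strict
    F j * (p + q) + F (suc j) * 0                   ≡⟨ cong (F j * (p + q) +_) (*-zeroʳ (F (suc j))) ⟩
    F j * (p + q) + 0                               ≤⟨ +-monoˡ-≤ 0 (*-monoʳ-≤ (F j) p+q≤) ⟩
    F j * F (3 + L) + 0
      <⟨ +-mono-≤-< (≤-reflexive (*-comm (F j) _)) (*-mono-≤ (F-suc-pos (suc L)) (F-pos 2≤j)) ⟩
    F (3 + L) * F j + F (2 + L) * F j               ≤⟨ +-monoˡ-≤ _ (*-monoʳ-≤ (F (3 + L)) (F-≤-suc j)) ⟩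
    F (3 + L) * F (suc j) + F (2 + L) * F j         ≡⟨ sym (F-+-≡ (2 + L) j k≡) ⟩
    F (suc k)                                       ∎
    where open ≤-Reasoning

  weight-step1 : ∀ L j k p q → k ≡ 2 + L + j → 2 ≤ j → Bounded (suc L) (p , q) → weight j (step 1 (p , q)) < F (suc k)
  weight-step1 L j k p q k≡ 2≤j pq-bounded = begin-strict
    F j * (p + q) + F (suc j) * q                                ≡⟨ regroup (F j) (F (suc j)) p q ⟩
    F j * p + (F j + F (suc j)) * q
      ≤⟨ bounded-linearʳ (suc L) p q (F j) (F (suc j)) pq-bounded ⟩
    F j * F (suc L) + (F j + F (suc j)) * F (2 + L)
      <⟨ +-mono-<-≤ (*-monoˡ-< (F (suc L)) {{>-nonZero (F-suc-pos L)}} (F-<-suc 2≤j))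
                    (≤-reflexive (cong (_* F (2 + L)) (+-comm (F j) (F (suc j))))) ⟩
    F (suc j) * F (suc L) + F (2 + j) * F (2 + L)                ≡⟨ +-comm (F (suc j) * F (suc L)) _ ⟩
    F (2 + j) * F (2 + L) + F (suc j) * F (suc L)                ≡⟨ sym (F-+-≡ (suc j) (suc L) (trans k≡ (reorder L j))) ⟩
    F (suc k)                                                    ∎
    where
    open ≤-Reasoning
    regroup : ∀ a c p q → a * (p + q) + c * q ≡ a * p + (a + c) * q
    regroup = solve-∀
    reorder : ∀ L j → 2 + L + j ≡ suc j + suc L
    reorder = solve-∀

  weight-step0-step0 : ∀ L j k p q → k ≡ 2 + L + j → 1 ≤ j → Bounded L (p , q) →
                       weight j (step 0 (step 0 (p , q))) ≤ F (suc k) strictIf (1 ≤ L)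
  weight-step0-step0 L j k p q k≡ 1≤j pq-bounded =
    ≤-trans X≤ (≤-reflexive (sym F[1+k])) , λ 1≤L → <-≤-trans (X< 1≤L) (≤-reflexive (sym F[1+k]))
    where
    open ≤-Reasoning
    regroup : ∀ a c p q → a * p + c * (p + (p + q)) ≡ (c + (c + a)) * p + c * q
    regroup = solve-∀
    reorder : ∀ L j → 2 + L + j ≡ 2 + j + L
    reorder = solve-∀
    F[1+k] = F-+-≡ (2 + j) L (trans k≡ (reorder L j))
    X = F j * p + F (suc j) * (p + (p + q))
    X≤F[3+j]*F[1+L]+F[1+j]*F[L] : X ≤ F (3 + j) * F (suc L) + F (suc j) * F L
    X≤F[3+j]*F[1+L]+F[1+j]*F[L] = begin
      X                                                    ≡⟨ regroup (F j) (F (suc j)) p q ⟩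
      (F (suc j) + F (2 + j)) * p + F (suc j) * q          ≤⟨ bounded-linearˡ L p q (F (suc j)) (F (2 + j)) pq-bounded ⟩
      (F (suc j) + F (2 + j)) * F (suc L) + F (suc j) * F L
        ≡⟨ cong (λ z → z * F (suc L) + F (suc j) * F L) (+-comm (F (suc j)) (F (2 + j))) ⟩
      F (3 + j) * F (suc L) + F (suc j) * F L              ∎
    X≤ : X ≤ F (3 + j) * F (suc L) + F (2 + j) * F L
    X≤ = ≤-trans X≤F[3+j]*F[1+L]+F[1+j]*F[L] (+-monoʳ-≤ _ (*-monoˡ-≤ (F L) (F-≤-suc (suc j))))
    X< : 1 ≤ L → X < F (3 + j) * F (suc L) + F (2 + j) * F L
    X< (s≤s {n = L′} z≤n) = ≤-<-trans X≤F[3+j]*F[1+L]+F[1+j]*F[L]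
      (+-monoʳ-< _ (*-monoˡ-< (F (suc L′)) {{>-nonZero (F-suc-pos L′)}} (F-<-suc (s≤s 1≤j))))

  weight-step0-step1 : ∀ j v → weight j (step 0 (step 1 v)) ≡ weight (2 + j) v
  weight-step0-step1 j (p , q) = regroup (F j) (F (suc j)) p q
    where
    regroup : ∀ a c p q → a * (p + q) + c * (p + q + q) ≡ (c + a) * p + ((c + a) + c) * q
    regroup = solve-∀

  weight-step0-step≥2 : ∀ L j k e p q → k ≡ 2 + L + j → Bounded L (p , q) →
                        weight j (step 0 (step (2 + e) (p , q))) < F (suc k)
  weight-step0-step≥2 L j k e p q k≡ (_ , _ , p+q≤) = begin-strict
    F j * (p + q) + F (suc j) * (p + q + 0)         ≡⟨ regroup (F j) (F (suc j)) (p + q) ⟩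
    F (2 + j) * (p + q) + 0                         ≤⟨ +-monoˡ-≤ 0 (*-monoʳ-≤ (F (2 + j)) p+q≤) ⟩
    F (2 + j) * F (2 + L) + 0                       <⟨ +-monoʳ-< _ (*-mono-≤ (F-suc-pos j) (F-suc-pos L)) ⟩
    F (2 + j) * F (2 + L) + F (suc j) * F (suc L)   ≡⟨ sym (F-+-≡ (suc j) (suc L) (trans k≡ (reorder L j))) ⟩
    F (suc k)                                       ∎
    where
    open ≤-Reasoning
    regroup : ∀ a c x → a * x + c * (x + 0) ≡ (c + a) * x + 0
    regroup = solve-∀
    reorder : ∀ L j → 2 + L + j ≡ suc j + suc L
    reorder = solve-∀

  h-shift-≤ˡ : ∀ L w → h b (2 + L) ≤ suc (1 * b ^ L + w) → h b L ≤ suc w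
  h-shift-≤ˡ L w ≤ = +-cancelˡ-≤ (b ^ L) _ _ (subst₂ _≤_ (h-rec L) (1*B+w+1≡B+[w+1] (b ^ L) w) ≤)

  h-shift-<ˡ : ∀ L w → h b (2 + L) < suc (1 * b ^ L + w) → h b L < suc w
  h-shift-<ˡ L w < = +-cancelˡ-< (b ^ L) _ _ (subst₂ _<_ (h-rec L) (1*B+w+1≡B+[w+1] (b ^ L) w) <)

  h-shift-≤ʳ : ∀ L w → suc (1 * b ^ L + w) ≤ h b (2 + L) → suc w ≤ h b L
  h-shift-≤ʳ L w ≤ = +-cancelˡ-≤ (b ^ L) _ _ (subst₂ _≤_ (1*B+w+1≡B+[w+1] (b ^ L) w) (h-rec L) ≤)

  h-shift-<ʳ : ∀ L w → suc (1 * b ^ L + w) < h b (2 + L) → suc w < h b L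
  h-shift-<ʳ L w < = +-cancelˡ-< (b ^ L) _ _ (subst₂ _<_ (1*B+w+1≡B+[w+1] (b ^ L) w) (h-rec L) <)

  digit≥2-exceeds-h : ∀ L d w → ¬ (suc ((2 + d) * b ^ L + w) ≤ h b (2 + L))
  digit≥2-exceeds-h L d w ≤h = <⇒≱ ≤h (begin
    h b (2 + L)           ≡⟨ h-rec L ⟩
    b ^ L + h b L         ≤⟨ +-monoʳ-≤ (b ^ L) (h-≤-b^ L) ⟩
    b ^ L + b ^ L         ≡⟨ cong (b ^ L +_) (sym (+-identityʳ (b ^ L))) ⟩
    2 * b ^ L             ≤⟨ *-monoˡ-≤ (b ^ L) (s≤s (s≤s (z≤n {d}))) ⟩
    (2 + d) * b ^ L       ≤⟨ m≤m+n _ w ⟩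
    (2 + d) * b ^ L + w   ∎)
    where open ≤-Reasoning

  -- The weights of R L w peak at w + 1 = h L; these two lemmas cover the two sides of the peak.
  weight-R-above-h : ∀ L j k → k ≡ L + j → 2 ≤ j → ∀ w → w < b ^ L → h b L ≤ suc w →
                     weight j (R L w) ≤ F (suc k) strictIf (h b L < suc w)
  weight-R-above-h zero j .j refl 2≤j w w<1 _ rewrite R-level0 w w<1 =
    ≤-trans (≤-reflexive Fj*1+0≡Fj) (F-≤-suc j) , λ _ → ≤-<-trans (≤-reflexive Fj*1+0≡Fj) (F-<-suc 2≤j)
    where
    Fj*1+0≡Fj : F j * 1 + F (suc j) * 0 ≡ F j
    Fj*1+0≡Fj = trans (cong₂ _+_ (*-identityʳ (F j)) (*-zeroʳ (F (suc j)))) (+-identityʳ (F j))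
  weight-R-above-h 1 j .(suc j) refl 2≤j w w<b^1 _ rewrite R-level1 w (subst (w <_) (*-identityʳ b) w<b^1) = digit w
    where
    Fj*1+0≡Fj : F j * 1 + F (suc j) * 0 ≡ F j
    Fj*1+0≡Fj = trans (cong₂ _+_ (*-identityʳ (F j)) (*-zeroʳ (F (suc j)))) (+-identityʳ (F j))
    digit : ∀ w → weight j (step w (1 , 0)) ≤ F (2 + j) strictIf (1 < suc w)
    digit zero = ≤-reflexive (regroup (F j) (F (suc j))) , λ { (s≤s ()) }
      where
      regroup : ∀ a c → a * 1 + c * (1 + 0) ≡ c + a
      regroup = solve-∀
    digit (suc w) = ≤-trans (≤-reflexive (weight≡ w)) (≤-trans (F-≤-suc j) (F-≤-suc (suc j))) ,
                    λ _ → ≤-<-trans (≤-reflexive (weight≡ w)) (<-≤-trans (F-<-suc 2≤j) (F-≤-suc (suc j)))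
      where
      weight≡ : ∀ w → weight j (step (suc w) (1 , 0)) ≡ F j
      weight≡ zero    = Fj*1+0≡Fj
      weight≡ (suc w) = Fj*1+0≡Fj
  weight-R-above-h (suc (suc L)) j k k≡ 2≤j w w<b^L h≤ with leadingDigit (suc L) w w<b^L
  ... | leading (suc (suc d)) w₁ _ w₁< _ R≡ rewrite R≡ =
    <⇒≤strictIf (weight-step≥2 L j k d _ _ k≡ 2≤j (R-bounded (suc L) w₁ w₁<))
  ... | leading 1 w₁ _ w₁< _ R≡ rewrite R≡ =
    <⇒≤strictIf (weight-step1 L j k _ _ k≡ 2≤j (R-bounded (suc L) w₁ w₁<))
  ... | leading zero w₁ _ w₁< refl R≡ rewrite R≡ with leadingDigit L w₁ w₁<
  ...   | leading (suc (suc e)) w₂ _ w₂< _ R≡′ rewrite R≡′ =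
    <⇒≤strictIf (weight-step0-step≥2 L j k e _ _ k≡ (R-bounded L w₂ w₂<))
  ...   | leading 1 w₂ _ w₂< refl R≡′ rewrite R≡′ | weight-step0-step1 j (R L w₂) =
    let bound = weight-R-above-h L (2 + j) k (trans k≡ (reorder L j)) (≤-trans 2≤j (m≤n+m j 2)) w₂ w₂< (h-shift-≤ˡ L w₂ h≤)
    in proj₁ bound , λ h< → proj₂ bound (h-shift-<ˡ L w₂ h<)
    where
    reorder : ∀ L j → 2 + L + j ≡ L + (2 + j)
    reorder = solve-∀
  ...   | leading zero w₂ _ w₂< refl R≡′ rewrite R≡′ =
    let bound = weight-step0-step0 L j k (R₁ L w₂) (R₂ L w₂) k≡ (≤-trans (n≤1+n 1) 2≤j) (R-bounded L w₂ w₂<)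
    in proj₁ bound , λ h< → proj₂ bound (h[2+L]<⇒1≤L L w₂< h<)

  weight-R-below-h : ∀ L j k → k ≡ L + j → 1 ≤ j → ∀ w → w < b ^ L → suc w ≤ h b L →
                     weight j (R L w) ≤ F (suc k) strictIf (suc w < h b L)
  weight-R-below-h zero j k k≡ 1≤j w _ ()
  weight-R-below-h 1 j .(suc j) refl 1≤j zero _ _ rewrite R-level1 0 z<s =
    ≤-reflexive (regroup (F j) (F (suc j))) , λ { (s≤s ()) }
    where
    regroup : ∀ a c → a * 1 + c * (1 + 0) ≡ c + a
    regroup = solve-∀
  weight-R-below-h 1 j k k≡ 1≤j (suc w) _ (s≤s ())
  weight-R-below-h (suc (suc L)) j k k≡ 1≤j w _ ≤h
    rewrite R-step0 (suc L) w (<-≤-trans ≤h (h-suc-≤-b^ (suc L)))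
    with leadingDigit L w (<-≤-trans ≤h (h-suc-≤-b^ (suc L)))
  ... | leading (suc (suc e)) w₂ _ _ refl _ = ⊥-elim (digit≥2-exceeds-h L e w₂ ≤h)
  ... | leading 1 w₂ _ w₂< refl R≡ rewrite R≡ | weight-step0-step1 j (R L w₂) =
    let bound = weight-R-below-h L (2 + j) k (trans k≡ (reorder L j)) (≤-trans 1≤j (m≤n+m j 2)) w₂ w₂< (h-shift-≤ʳ L w₂ ≤h)
    in proj₁ bound , λ <h → proj₂ bound (h-shift-<ʳ L w₂ <h)
    where
    reorder : ∀ L j → 2 + L + j ≡ L + (2 + j)
    reorder = solve-∀
  ... | leading zero w₂ _ w₂< refl R≡ rewrite R≡ =
    let bound = weight-step0-step0 L j k (R₁ L w₂) (R₂ L w₂) k≡ 1≤j (R-bounded L w₂ w₂<)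
    in proj₁ bound , λ <h → proj₂ bound (<h[2+L]⇒1≤L L <h)

  total : ℕ × ℕ → ℕ
  total (p , q) = p + q

  total≡weight1 : ∀ v → total v ≡ weight 1 v
  total≡weight1 (p , q) = regroup p q
    where
    regroup : ∀ p q → p + q ≡ 1 * p + 1 * q
    regroup = solve-∀

  total-R-between-h : ∀ K u → 1 ≤ K → h b (suc K) ≤ suc u → suc u ≤ h b (2 + K) →
                      total (R (suc K) u) ≤ F (3 + K) strictIf (h b (suc K) < suc u × suc u < h b (2 + K))
  total-R-between-h K u 1≤K h≤ ≤h with leadingDigit K u (<-≤-trans ≤h (h-suc-≤-b^ (suc K)))
  ... | leading (suc (suc d)) w _ _ refl _ = ⊥-elim (digit≥2-exceeds-h K d w ≤h)
  ... | leading 1 w _ w< refl R≡ rewrite R≡ =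
    let bound = weight-R-below-h K 2 (2 + K) (+-comm 2 K) (s≤s z≤n) w w< (h-shift-≤ʳ K w ≤h)
    in ≤-trans (≤-reflexive total≡weight2) (proj₁ bound) ,
       λ (_ , <h) → ≤-<-trans (≤-reflexive total≡weight2) (proj₂ bound (h-shift-<ʳ K w <h))
    where
    total≡weight2 : total (step 1 (R K w)) ≡ weight 2 (R K w)
    total≡weight2 = regroup (R₁ K w) (R₂ K w)
      where
      regroup : ∀ p q → p + q + q ≡ 1 * p + 2 * q
      regroup = solve-∀
  total-R-between-h zero u () h≤ ≤h | leading zero w _ w< refl R≡
  total-R-between-h (suc K) u _ h≤ ≤h | leading zero w _ w< refl R≡ rewrite R≡ | total≡weight1 (step 0 (R (suc K) w))
    with leadingDigit K w w<
  ... | leading (suc (suc e)) w₂ _ w₂< refl R≡′ rewrite R≡′ =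
    <⇒≤strictIf (weight-step0-step≥2 K 1 (3 + K) e _ _ (+-comm 1 (2 + K)) (R-bounded K w₂ w₂<))
  ... | leading 1 w₂ _ w₂< refl R≡′ rewrite R≡′ | weight-step0-step1 1 (R K w₂) =
    let bound = weight-R-above-h K 3 (K + 3) refl (s≤s (s≤s z≤n)) w₂ w₂< (h-shift-≤ˡ K w₂ h≤)
    in ≤-trans (proj₁ bound) (≤-reflexive (cong F (+-comm (suc K) 3))) ,
       λ (h< , _) → <-≤-trans (proj₂ bound (h-shift-<ˡ K w₂ h<)) (≤-reflexive (cong F (+-comm (suc K) 3)))
  ... | leading zero w₂ _ w₂< refl R≡′ rewrite R≡′ =
    let bound = weight-step0-step0 K 1 (3 + K) (R₁ K w₂) (R₂ K w₂) (+-comm 1 (2 + K)) ≤-refl (R-bounded K w₂ w₂<)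
    in proj₁ bound , λ (h< , _) → proj₂ bound (h[2+L]<⇒1≤L K w₂< h<)

  BelowLine : ℕ → ℕ → Set
  BelowLine K w = total (R K w) * gap (suc K) + F K * h b K ≤ F (2 + K) * gap (suc K) + F K * suc w

  -- Multiplied out by τ + σ: the value p + q + (1 + i) p is at most the σ : τ combination of the values
  -- at the two ends of the bracket, and both of those lie below the line.
  below-line-by-interpolation : ∀ p q i c a τ σ D f hK hj f₂ →
    p * (τ + σ) + a * hj ≤ c * (τ + σ) + a * (hj + τ) →
    p + q ≤ (c + a) + c →
    ((c + a) + c + suc i * c) * D + f * hK ≤ f₂ * D + f * hj →
    (((c + a) + c) + (c + a) + i * (c + a)) * D + f * hK ≤ f₂ * D + f * (hj + (τ + σ)) →
    1 ≤ τ + σ →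
    (p + (q + suc i * p)) * D + f * hK ≤ f₂ * D + f * (hj + τ)
  below-line-by-interpolation p q i c a τ σ D f hK hj f₂ p≤chord p+q≤ left≤ right≤ 1≤τ+σ =
    *-cancelʳ-≤ _ _ (τ + σ) {{>-nonZero 1≤τ+σ}} (begin
      ((p + (q + suc i * p)) * D + f * hK) * (τ + σ)              ≡⟨ regroup₁ p q i D f hK (τ + σ) ⟩
      ((p + q) * (τ + σ) + suc i * (p * (τ + σ))) * D + f * hK * (τ + σ)
        ≤⟨ +-monoˡ-≤ (f * hK * (τ + σ)) (*-monoˡ-≤ D (+-mono-≤ (*-monoˡ-≤ (τ + σ) p+q≤) (*-monoʳ-≤ (suc i) p≤chord′))) ⟩
      (((c + a) + c) * (τ + σ) + suc i * (c * (τ + σ) + a * τ)) * D + f * hK * (τ + σ)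
        ≡⟨ regroup₂ c a i τ σ D f hK ⟩
      σ * (((c + a) + c + suc i * c) * D + f * hK) + τ * ((((c + a) + c) + (c + a) + i * (c + a)) * D + f * hK)
        ≤⟨ +-mono-≤ (*-monoʳ-≤ σ left≤) (*-monoʳ-≤ τ right≤) ⟩
      σ * (f₂ * D + f * hj) + τ * (f₂ * D + f * (hj + (τ + σ)))   ≡⟨ regroup₃ f₂ D f hj τ σ ⟩
      (f₂ * D + f * (hj + τ)) * (τ + σ)                           ∎)
    where
    open ≤-Reasoning
    p≤chord′ : p * (τ + σ) ≤ c * (τ + σ) + a * τ
    p≤chord′ = +-cancelʳ-≤ (a * hj) _ _ (≤-trans p≤chord (≤-reflexive (regroup₀ c (τ + σ) a hj τ)))
      where
      regroup₀ : ∀ c D a hj τ → c * D + a * (hj + τ) ≡ c * D + a * τ + a * hj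
      regroup₀ = solve-∀
    regroup₁ : ∀ p q i D f hK E → ((p + (q + suc i * p)) * D + f * hK) * E ≡ ((p + q) * E + suc i * (p * E)) * D + f * hK * E
    regroup₁ = solve-∀
    regroup₂ : ∀ c a i τ σ D f hK → (((c + a) + c) * (τ + σ) + suc i * (c * (τ + σ) + a * τ)) * D + f * hK * (τ + σ) ≡
               σ * (((c + a) + c + suc i * c) * D + f * hK) + τ * ((((c + a) + c) + (c + a) + i * (c + a)) * D + f * hK)
    regroup₂ = solve-∀
    regroup₃ : ∀ f₂ D f hj τ σ → σ * (f₂ * D + f * hj) + τ * (f₂ * D + f * (hj + (τ + σ))) ≡ (f₂ * D + f * (hj + τ)) * (τ + σ)
    regroup₃ = solve-∀

  line-shift : ∀ P Dm FK hK hK1 F1 sw bK → hK1 + Dm ≡ bK + hK →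
    P * Dm + FK * hK ≤ (F1 + FK) * Dm + FK * sw → P * Dm + FK * hK1 ≤ F1 * Dm + FK * (bK + sw)
  line-shift P Dm FK hK hK1 F1 sw bK hK1+Dm≡bK+hK below = +-cancelʳ-≤ (FK * hK) _ _ (begin
    P * Dm + FK * hK1 + FK * hK             ≡⟨ regroup₁ P Dm FK hK hK1 ⟩
    P * Dm + FK * hK + FK * hK1             ≤⟨ +-monoˡ-≤ (FK * hK1) below ⟩
    (F1 + FK) * Dm + FK * sw + FK * hK1     ≡⟨ regroup₂ F1 FK Dm sw hK1 ⟩
    F1 * Dm + FK * (hK1 + Dm) + FK * sw     ≡⟨ cong (λ z → F1 * Dm + FK * z + FK * sw) hK1+Dm≡bK+hK ⟩
    F1 * Dm + FK * (bK + hK) + FK * sw      ≡⟨ regroup₃ F1 Dm FK bK hK sw ⟩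
    F1 * Dm + FK * (bK + sw) + FK * hK      ∎)
    where
    open ≤-Reasoning
    regroup₁ : ∀ P Dm FK hK hK1 → P * Dm + FK * hK1 + FK * hK ≡ P * Dm + FK * hK + FK * hK1
    regroup₁ = solve-∀
    regroup₂ : ∀ F1 FK Dm sw hK1 → (F1 + FK) * Dm + FK * sw + FK * hK1 ≡ F1 * Dm + FK * (hK1 + Dm) + FK * sw
    regroup₂ = solve-∀
    regroup₃ : ∀ F1 Dm FK bK hK sw → F1 * Dm + FK * (bK + hK) + FK * sw ≡ F1 * Dm + FK * (bK + sw) + FK * hK
    regroup₃ = solve-∀

  belowLine-in-bracket : ∀ i j₁ w → 1 ≤ j₁ → w < b ^ suc j₁ → h b (suc j₁) ≤ suc w → suc w ≤ h b (2 + j₁) →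
    R₁ (suc j₁) w * gap (suc j₁) + F j₁ * h b (suc j₁) ≤ F (suc j₁) * gap (suc j₁) + F j₁ * suc w →
    BelowLine (suc i + suc j₁) w
  belowLine-in-bracket i j₁ w 1≤j₁ w< h≤ ≤h R₁-below =
    subst₂ _≤_ (cong (λ z → z * D + f * h b K) (sym total≡)) (cong (λ z → f₂ * D + f * z) hj+τ≡w+1)
      (below-line-by-interpolation p q i c a τ σ D f (h b K) hj f₂ p≤chord p+q≤ left≤ right≤ 1≤τ+σ)
    where
    j  = suc j₁
    K  = suc i + j
    D  = gap (suc K)
    f  = F K
    f₂ = F (2 + K)
    p  = R₁ j w
    q  = R₂ j w
    c  = F j
    a  = F j₁
    hj = h b j
    τ  = suc w ∸ hj
    σ  = h b (suc j) ∸ suc w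
    hj+τ≡w+1 : hj + τ ≡ suc w
    hj+τ≡w+1 = m+[n∸m]≡n h≤
    τ+σ≡gap : τ + σ ≡ gap j
    τ+σ≡gap = +-cancelˡ-≡ hj _ _ (begin
      hj + (τ + σ)    ≡⟨ sym (+-assoc hj τ σ) ⟩
      hj + τ + σ      ≡⟨ cong (_+ σ) hj+τ≡w+1 ⟩
      suc w + σ       ≡⟨ m+[n∸m]≡n ≤h ⟩
      h b (suc j)     ≡⟨ sym (h+gap j) ⟩
      hj + gap j      ∎)
      where open ≡-Reasoning
    total≡ : total (R K w) ≡ p + (q + suc i * p)
    total≡ = cong total (R-zeros (suc i) j w w<)
    p≤chord : p * (τ + σ) + a * hj ≤ c * (τ + σ) + a * (hj + τ)
    p≤chord = subst₂ (λ x y → p * x + a * hj ≤ c * x + a * y) (sym τ+σ≡gap) (sym hj+τ≡w+1) R₁-below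
    p+q≤ : p + q ≤ (c + a) + c
    p+q≤ = proj₁ (total-R-between-h j₁ w 1≤j₁ h≤ ≤h)
    left≤ = peaks-below-line (suc i) j K refl (s≤s 1≤j₁)
    right≤ : (((c + a) + c) + (c + a) + i * (c + a)) * D + f * h b K ≤ f₂ * D + f * (hj + (τ + σ))
    right≤ = ≤-trans (peaks-below-line i (suc j) K (sym (+-suc i j)) (≤-trans (s≤s 1≤j₁) (n≤1+n j)))
                     (≤-reflexive (cong (λ z → f₂ * D + f * z) (trans (sym (h+gap j)) (cong (hj +_) (sym τ+σ≡gap)))))
    1≤τ+σ : 1 ≤ τ + σ
    1≤τ+σ = subst (1 ≤_) (sym τ+σ≡gap) (gap-suc-pos 1≤j₁)

  R₁-below-chord : ∀ K → Acc _<_ K → ∀ u → 1 ≤ K → h b (suc K) ≤ suc u → suc u ≤ h b (2 + K) →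
    R₁ (suc K) u * gap (suc K) + F K * h b (suc K) ≤ F (suc K) * gap (suc K) + F K * suc u
  R₁-below-chord K (acc smaller) u 1≤K h≤ ≤h with leadingDigit K u (<-≤-trans ≤h (h-suc-≤-b^ (suc K)))
  ... | leading (suc (suc d)) w _ _ refl _ = ⊥-elim (digit≥2-exceeds-h K d w ≤h)
  ... | leading zero w _ w< refl R≡ rewrite R≡ =
    +-mono-≤ (*-monoˡ-≤ (gap (suc K)) (proj₁ (R-bounded K w w<))) (*-monoʳ-≤ (F K) h≤)
  ... | leading 1 w _ w< refl R≡ rewrite R≡ =
    subst (λ z → total (R K w) * gap (suc K) + F K * h b (suc K) ≤ F (suc K) * gap (suc K) + F K * z)
          (sym (1*B+w+1≡B+[w+1] (b ^ K) w))
          (line-shift (total (R K w)) (gap (suc K)) (F K) (h b K) (h b (suc K)) (F (suc K)) (suc w) (b ^ K)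
                      (trans (h+gap (suc K)) (h-rec K)) belowLine)
    where
    w+1≤h : suc w ≤ h b K
    w+1≤h = h-shift-≤ʳ K w ≤h
    belowLine : BelowLine K w
    belowLine with m≤n⇒m<n∨m≡n w+1≤h
    ... | inj₂ w+1≡h = ≤-trans (+-monoˡ-≤ (F K * h b K) (*-monoˡ-≤ (gap (suc K)) total≤))
                               (≤-reflexive (cong (λ z → F (2 + K) * gap (suc K) + F K * z) (sym w+1≡h)))
      where
      total≤ : total (R K w) ≤ F (2 + K)
      total≤ = ≤-trans (≤-reflexive (total≡weight1 (R K w)))
                       (proj₁ (weight-R-below-h K 1 (suc K) (+-comm 1 K) ≤-refl w w< w+1≤h))
    ... | inj₁ w+1<h with h-bracket K w w+1<h
    ...   | suc j₁ , s≤s 1≤j₁ , j<K , h≤′ , ≤h′ with m<n⇒∃[i]suc-i+m≡n j<K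
    ...     | i , refl =
      belowLine-in-bracket i j₁ w 1≤j₁ (<-≤-trans ≤h′ (h-suc-≤-b^ (suc j₁))) h≤′ ≤h′
        (R₁-below-chord j₁ (smaller (<-≤-trans (n<1+n j₁) (m≤n+m (suc j₁) (suc i)))) w 1≤j₁ h≤′ ≤h′)

  shifted-below-chord : ∀ K i u → 1 ≤ K → h b (suc K) < suc u → suc u < h b (2 + K) →
    (i * R₁ (suc K) u + total (R (suc K) u)) * gap (suc K)
      < i * F K * (suc u ∸ h b (suc K)) + (F (3 + K) + i * F (suc K)) * gap (suc K)
  shifted-below-chord K i u 1≤K h< <h = begin-strict
    (i * p + t) * D                             ≡⟨ regroup₁ i p t D ⟩
    i * (p * D) + t * D
      <⟨ +-mono-≤-< (*-monoʳ-≤ i p≤chord) (*-monoˡ-< D {{>-nonZero (gap-suc-pos 1≤K)}} t<) ⟩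
    i * (F (suc K) * D + F K * τ) + F (3 + K) * D  ≡⟨ regroup₂ i (F (suc K)) D (F K) τ (F (3 + K)) ⟩
    i * F K * τ + (F (3 + K) + i * F (suc K)) * D  ∎
    where
    open ≤-Reasoning
    p = R₁ (suc K) u
    t = total (R (suc K) u)
    D = gap (suc K)
    τ = suc u ∸ h b (suc K)
    t< : t < F (3 + K)
    t< = proj₂ (total-R-between-h K u 1≤K (<⇒≤ h<) (<⇒≤ <h)) (h< , <h)
    p≤chord : p * D ≤ F (suc K) * D + F K * τ
    p≤chord = +-cancelʳ-≤ (F K * h b (suc K)) _ _ (begin
      p * D + F K * h b (suc K)                 ≤⟨ R₁-below-chord K (<-wellFounded K) u 1≤K (<⇒≤ h<) (<⇒≤ <h) ⟩
      F (suc K) * D + F K * suc u               ≡⟨ cong (λ z → F (suc K) * D + F K * z) (sym (m∸n+n≡m (<⇒≤ h<))) ⟩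
      F (suc K) * D + F K * (τ + h b (suc K))   ≡⟨ distrib (F (suc K) * D) (F K) τ (h b (suc K)) ⟩
      F (suc K) * D + F K * τ + F K * h b (suc K)  ∎)
      where
      distrib : ∀ A f t x → A + f * (t + x) ≡ A + f * t + f * x
      distrib = solve-∀
    regroup₁ : ∀ i p t D → (i * p + t) * D ≡ i * (p * D) + t * D
    regroup₁ = solve-∀
    regroup₂ : ∀ i a D f t c → i * (a * D + f * t) + c * D ≡ i * f * t + (c + i * a) * D
    regroup₂ = solve-∀

module ChordBound (b' : ℕ) where

  open Gaps b'
  open Expansions b' using (ways; waysPair; waysPair-step; s-split; s-suc≡ways; ways-zero; ways-one-≤; ways-one->)
  open Bounds b' waysPair refl waysPair-step using (R₁; R₂; total; R-zeros; shifted-below-chord)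

  s-b^ : ∀ j → s b (b ^ j) ≡ 1
  s-b^ zero    = refl
  s-b^ (suc j) = begin
    s b (b * b ^ j)                               ≡⟨ cong (s b) (sym b^[1+j]≡) ⟩
    s b (suc (a * b ^ 1 + suc b'))                ≡⟨ s-split 1 a (suc b') (≤-reflexive (sym (*-identityʳ b))) ⟩
    s b (suc a) * ways 1 (suc b') + s b a * ways 1 (b ^ 1 + suc b')
      ≡⟨ cong₂ (λ x y → s b (suc a) * x + s b a * y) (ways-one-≤ (suc b') (n≤1+n (suc b')))
               (ways-one-> (b ^ 1 + suc b') (subst (_< b ^ 1 + suc b') (*-identityʳ b) (m<m+n (b ^ 1) z<s))) ⟩
    s b (suc a) * 1 + s b a * 0                   ≡⟨ cong₂ _+_ (*-identityʳ _) (*-zeroʳ (s b a)) ⟩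
    s b (suc a) + 0                               ≡⟨ +-identityʳ _ ⟩
    s b (suc a)                                   ≡⟨ cong (s b) 1+a≡b^j ⟩
    s b (b ^ j)                                   ≡⟨ s-b^ j ⟩
    1                                             ∎
    where
    open ≡-Reasoning
    a = b ^ j ∸ 1
    1+a≡b^j : suc a ≡ b ^ j
    1+a≡b^j = trans (+-comm 1 a) (m∸n+n≡m (b^-pos j))
    b^[1+j]≡ : suc (a * b ^ 1 + suc b') ≡ b * b ^ j
    b^[1+j]≡ = begin
      suc (a * b ^ 1 + suc b')  ≡⟨ cong (λ z → suc (a * z + suc b')) (*-identityʳ b) ⟩
      suc (a * b + suc b')      ≡⟨ regroup a b' ⟩
      suc a * b                 ≡⟨ cong (_* b) 1+a≡b^j ⟩
      b ^ j * b                 ≡⟨ *-comm (b ^ j) b ⟩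
      b * b ^ j                 ∎
      where
      regroup : ∀ x b' → suc (x * (2 + b') + suc b') ≡ suc x * (2 + b')
      regroup = solve-∀

  s-suc-b^ : ∀ j → s b (suc (b ^ j)) ≡ suc j
  s-suc-b^ j = begin
    s b (suc (b ^ j))
      ≡⟨ cong (λ z → s b (suc z)) (sym (trans (+-identityʳ _) (*-identityˡ (b ^ j)))) ⟩
    s b (suc (1 * b ^ j + 0))                        ≡⟨ s-split j 1 0 (b^-pos j) ⟩
    s b 2 * ways j 0 + s b 1 * ways j (b ^ j + 0)    ≡⟨ cong (λ x → x * ways j 0 + 1 * ways j (b ^ j + 0)) s2≡1 ⟩
    1 * ways j 0 + 1 * ways j (b ^ j + 0)            ≡⟨ cong₂ (λ x y → 1 * x + 1 * y) (ways-zero j) ways[b^j]≡j ⟩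
    1 * 1 + 1 * j                                    ≡⟨ cong suc (+-identityʳ j) ⟩
    suc j                                            ∎
    where
    open ≡-Reasoning
    s2≡1 : s b 2 ≡ 1
    s2≡1 = trans (s-suc≡ways 1 1 (≤-trans b≥2 (≤-reflexive (sym (*-identityʳ b))))) (ways-one-≤ 1 (s≤s z≤n))
    ways[b^j]≡j : ways j (b ^ j + 0) ≡ j
    ways[b^j]≡j = trans (cong proj₂ (trans (cong (λ z → waysPair z 0) (sym (+-identityʳ j))) (R-zeros j 0 0 z<s)))
                        (*-identityʳ j)

  s-b^+ : ∀ i m u → u < b ^ m → s b (b ^ (i + m) + suc u) ≡ i * R₁ m u + total (waysPair m u)
  s-b^+ i m u u<b^m = begin
    s b (b ^ (i + m) + suc u)
      ≡⟨ cong (s b) (trans (+-suc _ u) (cong (λ z → suc (z + u)) (^-distribˡ-+-* b i m))) ⟩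
    s b (suc (b ^ i * b ^ m + u))           ≡⟨ s-split m (b ^ i) u u<b^m ⟩
    s b (suc (b ^ i)) * ways m u + s b (b ^ i) * ways m (b ^ m + u)
      ≡⟨ cong₂ (λ x y → x * ways m u + y * ways m (b ^ m + u)) (s-suc-b^ i) (s-b^ i) ⟩
    suc i * ways m u + 1 * ways m (b ^ m + u)  ≡⟨ regroup i (ways m u) (ways m (b ^ m + u)) ⟩
    i * ways m u + (ways m u + ways m (b ^ m + u))  ∎
    where
    open ≡-Reasoning
    regroup : ∀ i p q → suc i * p + 1 * q ≡ i * p + (p + q)
    regroup = solve-∀

  H-at : ∀ i m → H (i + m) m ≡ F (2 + m) + i * F m
  H-at i m = cong₂ (λ x y → F x + y * F m) (+-comm m 2) (m+n∸n≡m i m)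

  H-suc : ∀ i K → H (suc i + suc K) (2 + K) ≡ H (suc i + suc K) (suc K) + suc i * F K
  H-suc i K = begin
    H (suc i + suc K) (2 + K)                     ≡⟨ cong (λ k → H k (2 + K)) (sym (+-suc i (suc K))) ⟩
    H (i + (2 + K)) (2 + K)                       ≡⟨ H-at i (2 + K) ⟩
    F (4 + K) + i * F (2 + K)                     ≡⟨ regroup (F (suc K)) (F K) (F (3 + K)) i ⟩
    F (3 + K) + suc i * F (suc K) + suc i * F K   ≡⟨ cong (_+ suc i * F K) (sym (H-at (suc i) (suc K))) ⟩
    H (suc i + suc K) (suc K) + suc i * F K       ∎
    where
    open ≡-Reasoning
    regroup : ∀ x y z i → z + (x + y) + i * (x + y) ≡ z + suc i * x + suc i * y
    regroup = solve-∀

  G-≤-suc : ∀ k m → G b k m ≤ G b k (suc m)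
  G-≤-suc k m = +-monoʳ-≤ (b ^ k) (h-≤-suc m)

  H-≤-suc : ∀ i m → 1 ≤ m → H (suc i + m) m ≤ H (suc i + m) (suc m)
  H-≤-suc i (suc K) _ = ≤-trans (m≤m+n _ _) (≤-reflexive (sym (H-suc i K)))

  s-below-chordℕ : ∀ i m n → 2 ≤ m → G b (suc i + m) m < n → n < G b (suc i + m) (suc m) →
    s b n * (G b (suc i + m) (suc m) ∸ G b (suc i + m) m)
      < (H (suc i + m) (suc m) ∸ H (suc i + m) m) * (n ∸ G b (suc i + m) m)
        + H (suc i + m) m * (G b (suc i + m) (suc m) ∸ G b (suc i + m) m)
  s-below-chordℕ i (suc K) n (s≤s 1≤K) G<n n<G with m≤n⇒∃[o]m+o≡n (≤-<-trans (m≤m+n (b ^ (suc i + suc K)) _) G<n)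
  ... | u , refl = subst₂ _<_ (sym lhs) (sym rhs) (shifted-below-chord K (suc i) u 1≤K h<u+1 u+1<h)
    where
    k = suc i + suc K
    n≡ : suc (b ^ k + u) ≡ b ^ k + suc u
    n≡ = sym (+-suc (b ^ k) u)
    h<u+1 : h b (suc K) < suc u
    h<u+1 = +-cancelˡ-< (b ^ k) _ _ (subst (G b k (suc K) <_) n≡ G<n)
    u+1<h : suc u < h b (2 + K)
    u+1<h = +-cancelˡ-< (b ^ k) _ _ (subst (_< G b k (2 + K)) n≡ n<G)
    ΔG : G b k (2 + K) ∸ G b k (suc K) ≡ gap (suc K)
    ΔG = [m+n]∸[m+o]≡n∸o (b ^ k) (h b (2 + K)) (h b (suc K))
    u<b^[1+K] : u < b ^ suc K
    u<b^[1+K] = <-≤-trans (<-trans (n<1+n u) u+1<h) (h-suc-≤-b^ (suc K))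
    lhs : s b (suc (b ^ k + u)) * (G b k (2 + K) ∸ G b k (suc K))
          ≡ (suc i * R₁ (suc K) u + total (waysPair (suc K) u)) * gap (suc K)
    lhs = cong₂ _*_ (trans (cong (s b) n≡) (s-b^+ (suc i) (suc K) u u<b^[1+K])) ΔG
    rhs : (H k (2 + K) ∸ H k (suc K)) * (suc (b ^ k + u) ∸ G b k (suc K)) + H k (suc K) * (G b k (2 + K) ∸ G b k (suc K))
          ≡ suc i * F K * (suc u ∸ h b (suc K)) + (F (3 + K) + suc i * F (suc K)) * gap (suc K)
    rhs = cong₂ _+_
      (cong₂ _*_ (trans (cong (_∸ H k (suc K)) (H-suc i K)) (m+n∸m≡n (H k (suc K)) (suc i * F K)))
                 (trans (cong (_∸ G b k (suc K)) n≡) ([m+n]∸[m+o]≡n∸o (b ^ k) (suc u) (h b (suc K)))))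
      (cong₂ _*_ (H-at (suc i) (suc K)) ΔG)

+a-+c≡+[a∸c] : ∀ {a c} → c ≤ a → ℤ.+ a ℤ.- ℤ.+ c ≡ ℤ.+ (a ∸ c)
+a-+c≡+[a∸c] {a} {c} c≤a = trans (ℤ.m-n≡m⊖n a c) (ℤ.⊖-≥ c≤a)

chord-inequality-ℕ⇒ℤ : ∀ {x g₀ g₁ y₀ y₁ n} → g₀ ≤ g₁ → y₀ ≤ y₁ → g₀ ≤ n →
  x * (g₁ ∸ g₀) < (y₁ ∸ y₀) * (n ∸ g₀) + y₀ * (g₁ ∸ g₀) →
  ℤ.+ x ℤ.* (ℤ.+ g₁ ℤ.- ℤ.+ g₀)
    ℤ.< (ℤ.+ y₁ ℤ.- ℤ.+ y₀) ℤ.* (ℤ.+ n ℤ.- ℤ.+ g₀) ℤ.+ ℤ.+ y₀ ℤ.* (ℤ.+ g₁ ℤ.- ℤ.+ g₀)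
chord-inequality-ℕ⇒ℤ {x} {g₀} {g₁} {y₀} {y₁} {n} g₀≤g₁ y₀≤y₁ g₀≤n ineq
  rewrite +a-+c≡+[a∸c] g₀≤g₁ | +a-+c≡+[a∸c] y₀≤y₁ | +a-+c≡+[a∸c] g₀≤n
        | sym (ℤ.pos-* x (g₁ ∸ g₀)) | sym (ℤ.pos-* (y₁ ∸ y₀) (n ∸ g₀)) | sym (ℤ.pos-* y₀ (g₁ ∸ g₀))
        | sym (ℤ.pos-+ ((y₁ ∸ y₀) * (n ∸ g₀)) (y₀ * (g₁ ∸ g₀)))
  = ℤ.+<+ ineq

theorem34 : (b k m n : ℕ) → 2 ≤ b → 2 ≤ m → m < k →
  G b k m < n → n < G b k (suc m) →
  (ℤ.+ s b n) ℤ.* ((ℤ.+ G b k (suc m)) ℤ.- (ℤ.+ G b k m))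
    ℤ.<
  ((ℤ.+ H k (suc m)) ℤ.- (ℤ.+ H k m)) ℤ.* ((ℤ.+ n) ℤ.- (ℤ.+ G b k m))
    ℤ.+ (ℤ.+ H k m) ℤ.* ((ℤ.+ G b k (suc m)) ℤ.- (ℤ.+ G b k m))
theorem34 (suc zero) k m n (s≤s ())
theorem34 (suc (suc b')) k m n _ 2≤m m<k G<n n<G with m<n⇒∃[i]suc-i+m≡n m<k
... | i , refl = chord-inequality-ℕ⇒ℤ {s (2 + b') n} (G-≤-suc k m) (H-≤-suc i m (≤-trans (n≤1+n 1) 2≤m)) (<⇒≤ G<n)
                   (s-below-chordℕ i m n 2≤m G<n n<G)
  where open ChordBound b'
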